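{- Let $a,b$ be nonnegative integers with $a+b\ge 3$, and let $T=B(3,a,b)$. Then the number of edges of $\mathcal{B}_3(T)$ is \[|E(\mathcal{B}_3(T))|=(2(a+b)+1)2^{a+b-1}+2^a+2^b-1.\]
   Context: The double broom $B(3,a,b)$ is the tree obtained from a path $u$–$v$–$w$ by attaching $a$ leaves to $u$ and $b$ leaves to $w$. A stable $k$-partition of a graph $G$ is a multiset of $k$ independent sets (some possibly empty) partitioning $V(G)$; $P-v$ is obtained by deleting $v$ from its part. $\mathcal{B}_k(G)$ has vertex set the stable $k$-partitions of $G$, with distinct $P,Q$ adjacent iff $P-v=Q-v$ for some $v\in V(G)$. -}

module Defs where

open import Data.Nat using (ℕ; zero; suc; _+_; _*_; _∸_; _^_; _≤_; _≡ᵇ_; _<ᵇ_; _≤ᵇ_)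
open import Data.Bool using (Bool; true; false; _∧_; _∨_; not; if_then_else_)
open import Data.Fin using (Fin; toℕ; _<?_)
open import Data.Fin.Properties using (_≟_)
open import Data.List using (List; []; _∷_; [_]; concatMap; map; filterᵇ; length; allFin)
open import Data.Bool.ListAction using (all; any)
open import Data.Vec using (Vec; lookup) renaming ([] to []ᵛ; _∷_ to _∷ᵛ_)
open import Relation.Nullary.Decidable using (⌊_⌋)

Graph : ℕ → Set
Graph n = Fin n → Fin n → Bool

-- The double broom B(3,a,b) on vertex set Fin (3 + a + b):
-- vertex 0 = u, vertex 1 = v, vertex 2 = w,
-- vertices 3 .. 3+a-1 are the a leaves attached to u,
-- vertices 3+a .. 3+a+b-1 are the b leaves attached to w.
broomArc : ℕ → ℕ → ℕ → Bool
broomArc a p q =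
  ((p ≡ᵇ 0) ∧ (q ≡ᵇ 1))
  ∨ ((p ≡ᵇ 1) ∧ (q ≡ᵇ 2))
  ∨ ((p ≡ᵇ 0) ∧ (3 ≤ᵇ q) ∧ (q <ᵇ 3 + a))
  ∨ ((p ≡ᵇ 2) ∧ (3 + a ≤ᵇ q))

doubleBroom : (a b : ℕ) → Graph (3 + a + b)
doubleBroom a b i j = broomArc a (toℕ i) (toℕ j) ∨ broomArc a (toℕ j) (toℕ i)

allF : (n : ℕ) → (Fin n → Bool) → Bool
allF n p = all p (allFin n)

anyF : (n : ℕ) → (Fin n → Bool) → Bool
anyF n p = any p (allFin n)

eqF : {n : ℕ} → Fin n → Fin n → Bool
eqF i j = ⌊ i ≟ j ⌋

ltF : {n : ℕ} → Fin n → Fin n → Bool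
ltF i j = ⌊ i <? j ⌋

-- A partition of Fin n is encoded by its "same part" relation, an
-- n×n Boolean matrix R (R i j = true iff i and j lie in the same part).
Rel : ℕ → Set
Rel n = Vec (Vec Bool n) n

rel : {n : ℕ} → Rel n → Fin n → Fin n → Bool
rel R i j = lookup (lookup R i) j

isEquivalence : (n : ℕ) → Rel n → Bool
isEquivalence n R =
  allF n (λ i → rel R i i)
  ∧ allF n (λ i → allF n (λ j → not (rel R i j) ∨ rel R j i))
  ∧ allF n (λ i → allF n (λ j → allF n (λ k →
       not (rel R i j ∧ rel R j k) ∨ rel R i k)))

numParts : (n : ℕ) → Rel n → ℕ
numParts n R =
  length (filterᵇ (λ i → not (anyF n (λ j → ltF j i ∧ rel R i j))) (allFin n))

partsIndependent : (n : ℕ) → Graph n → Rel n → Bool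
partsIndependent n G R =
  allF n (λ i → allF n (λ j → not (G i j ∧ rel R i j)))

-- R encodes a stable k-partition of G: a multiset of k independent sets
-- (some possibly empty) partitioning V(G).  Such a multiset is determined
-- by its nonempty parts, i.e. by a set partition of V(G) into at most k
-- independent blocks (the remaining k - #blocks parts being empty).
isStablePartition : (n k : ℕ) → Graph n → Rel n → Bool
isStablePartition n k G R =
  isEquivalence n R ∧ (numParts n R ≤ᵇ k) ∧ partsIndependent n G R

allVecs : {A : Set} → List A → (m : ℕ) → List (Vec A m)
allVecs xs zero = [ []ᵛ ]
allVecs xs (suc m) = concatMap (λ v → map (λ x → x ∷ᵛ v) xs) (allVecs xs m)

allRels : (n : ℕ) → List (Rel n)
allRels n = allVecs (allVecs (true ∷ false ∷ []) n) n

-- the vertex set of B_k(G), each stable k-partition listed exactly once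
stablePartitions : (n k : ℕ) → Graph n → List (Rel n)
stablePartitions n k G = filterᵇ (isStablePartition n k G) (allRels n)

sameRel : (n : ℕ) → Rel n → Rel n → Bool
sameRel n P Q = allF n (λ i → allF n (λ j → rel P i j ≡ᵇᵇ rel Q i j))
  where
  _≡ᵇᵇ_ : Bool → Bool → Bool
  true ≡ᵇᵇ y = y
  false ≡ᵇᵇ y = not y

-- P - v = Q - v : removing v from its part in P and in Q yields the same
-- multiset, i.e. P and Q induce the same partition of V(G) \ {v}
-- (a part becoming empty after the removal is an empty part of the multiset).
agreeOff : (n : ℕ) → Rel n → Rel n → Fin n → Bool
agreeOff n P Q v =
  allF n (λ i → allF n (λ j →
    eqF i v ∨ eqF j v ∨ ((rel P i j ∧ rel Q i j) ∨ (not (rel P i j) ∧ not (rel Q i j)))))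

reconfAdj : (n : ℕ) → Rel n → Rel n → Bool
reconfAdj n P Q = not (sameRel n P Q) ∧ anyF n (agreeOff n P Q)

-- number of edges of the graph on a duplicate-free vertex list with
-- symmetric adjacency: number of pairs at positions i < j that are adjacent
countEdges : {X : Set} → (X → X → Bool) → List X → ℕ
countEdges adj [] = 0
countEdges adj (x ∷ xs) = length (filterᵇ (adj x) xs) + countEdges adj xs

reconfEdges : (n k : ℕ) → Graph n → ℕ
reconfEdges n k G = countEdges (reconfAdj n) (stablePartitions n k G)

{-# OPTIONS --safe #-}
module Submission where

-- A stable 3-partition of T is the kernel of a proper 3-colouring. Renaming the colours so that
-- v gets 0 and u gets 1 leaves a code (s , X): s says whether u and w share a part, and X
-- which leaves avoid the part of v. Every code arises exactly once, so B₃(T) has 2·2^m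
-- vertices, m = a + b. Two codes are adjacent exactly when one vertex moves: a leaf (one bit
-- of X flips), v while u and w share a part (X is complemented), or u or w leaving the other
-- (s flips, and no leaf of the moving vertex may lie in the third part). For fixed s the
-- graph is (m+1)- resp. m-regular once m ≥ 2, so the handshake lemma gives (m+1)·2^(m-1) and
-- m·2^(m-1) edges, and the edges between the two layers are counted by the X vanishing on
-- the leaves of u or on those of w: 2^a + 2^b - 1 of them.

open import Defs

open import Data.Bool as Bool using (Bool; true; false; _∧_; _∨_; not; if_then_else_; T; T?)
open import Data.Bool.Properties
  using ( T-∧; T-∨; T-irrelevant; ∧-identityʳ; ∧-zeroʳ
        ; not-involutive; not-¬; not-injective; ¬-not)
open import Data.Empty using (⊥; ⊥-elim)
open import Data.Fin using (Fin; zero; suc; inject≤; _<_; toℕ; fromℕ<)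
open import Data.Fin.Induction using (<-wellFounded)
open import Data.Fin.Permutation.Components using (transpose; transpose-inverse)
open import Data.Fin.Properties
  using (_≟_; <-cmp; inject≤-injective; injective⇒≤; ¬∀⟶∃¬; suc-injective; all?)
open import Data.List
  using (List; []; _∷_; _++_; length; filterᵇ; map; allFin; lookup; concatMap; cartesianProductWith)
open import Data.List.Membership.Propositional using (_∈_; lose)
open import Data.List.Membership.Propositional.Properties
  using ( ∈-allFin; ∈-filter⁺; ∈-filter⁻; ∈-lookup; ∈-map⁺; ∈-map⁻
        ; ∈-concat⁺′; ∈-++⁺ˡ; ∈-++⁺ʳ)
open import Data.List.Membership.Propositional.Properties.WithK using (unique∧set⇒bag)
open import Data.List.Properties using (filter-++; length-++; map-cong; map-∘; filter-none)
open import Data.List.Relation.Binary.BagAndSetEquality using (∼bag⇒↭)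
open import Data.List.Relation.Binary.Permutation.Propositional
  using (_↭_; prep; swap) renaming (refl to ↭-refl; trans to ↭-trans)
open import Data.List.Relation.Binary.Permutation.Propositional.Properties using (↭-length; filter-↭)
open import Data.List.Relation.Unary.All as All using ([]; _∷_)
open import Data.List.Relation.Unary.All.Properties using (all⁺; all⁻)
open import Data.List.Relation.Unary.AllPairs using ([]; _∷_)
open import Data.List.Relation.Unary.Any using (here; there; index; satisfied)
open import Data.List.Relation.Unary.Any.Properties using (any⁺; any⁻; lookup-index)
open import Data.List.Relation.Unary.Unique.Propositional using (Unique)
import Data.List.Relation.Unary.Unique.Propositional.Properties as Unique
open import Data.Nat using (ℕ; zero; suc; _+_; _*_; _∸_; _^_; _≤_; _≤ᵇ_; _<ᵇ_; s≤s; z≤n)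
open import Data.Nat.ListAction using (sum)
open import Data.Nat.Properties
  using ( ≤ᵇ⇒≤; ≤⇒≤ᵇ; +-commutativeSemigroup; +-identityʳ; +-comm; +-assoc
        ; *-assoc; *-cancelˡ-≡; m+n∸n≡m; m+[n∸m]≡n; ≤-trans; n≤1+n)
open import Algebra.Properties.CommutativeSemigroup +-commutativeSemigroup using (interchange)
open import Data.Nat.Solver using (module +-*-Solver)
open +-*-Solver using (solve; _:+_; _:*_; _:=_; con)
open import Data.Product as Product using (∃; _×_; _,_; proj₁; proj₂)
open import Data.Sum using (_⊎_; inj₁; inj₂; [_,_])
open import Data.Unit using (tt)
open import Data.Vec as Vec using (Vec; tabulate) renaming ([] to []ᵛ; _∷_ to _∷ᵛ_)
open import Data.Vec.Properties
  using ( lookup∘tabulate; tabulate∘lookup; tabulate-cong; ∷-injective; ≡-dec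
        ; lookup-map; lookup-replicate)
open import Function using (_∘_; id; Injective; Equivalence; mk⇔)
open import Induction.WellFounded using (Acc; acc)
open import Relation.Binary using (tri<; tri≈; tri>; IsEquivalence; DecidableEquality)
open import Relation.Binary.PropositionalEquality
  using (_≡_; _≢_; refl; sym; trans; cong; cong₂; subst; module ≡-Reasoning)
open import Relation.Nullary using (¬_; Dec; yes; no)
open import Relation.Nullary.Decidable
  using (⌊_⌋; toWitness; fromWitness; dec-no; from-yes; _→-dec_; ¬?)

T-ext : ∀ {x y} → (T x → T y) → (T y → T x) → x ≡ y
T-ext {false} {false} _ _ = refl
T-ext {false} {true}  _ g = ⊥-elim (g tt)
T-ext {true}  {false} f _ = ⊥-elim (f tt)
T-ext {true}  {true}  _ _ = refl

T-not⁺ : ∀ {x} → ¬ T x → T (not x)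
T-not⁺ {false} _ = tt
T-not⁺ {true}  h = h tt

T-not⁻ : ∀ {x} → T (not x) → ¬ T x
T-not⁻ {false} _ ()

¬T-not : ∀ {x} → ¬ T (not x) → T x
¬T-not {false} h = ⊥-elim (h tt)
¬T-not {true}  _ = tt

T-⇒⁺ : ∀ {x y} → (T x → T y) → T (not x ∨ y)
T-⇒⁺ {false} _ = tt
T-⇒⁺ {true}  h = h tt

T-⇒⁻ : ∀ {x y} → T (not x ∨ y) → T x → T y
T-⇒⁻ {true} h _ = h

¬T⇒false : ∀ {x} → ¬ T x → x ≡ false
¬T⇒false {false} _ = refl
¬T⇒false {true}  h = ⊥-elim (h tt)

T-∧⁺ : ∀ {x y} → T x → T y → T (x ∧ y)
T-∧⁺ p q = Equivalence.from T-∧ (p , q)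

T-∧⁻ : ∀ {x y} → T (x ∧ y) → T x × T y
T-∧⁻ = Equivalence.to T-∧

T-∨⁺ˡ : ∀ {x y} → T x → T (x ∨ y)
T-∨⁺ˡ {true} _ = tt

T-∨⁺ʳ : ∀ {x y} → T y → T (x ∨ y)
T-∨⁺ʳ {true}  _ = tt
T-∨⁺ʳ {false} h = h

T-∨⁻ : ∀ {x y} → T (x ∨ y) → T x ⊎ T y
T-∨⁻ = Equivalence.to T-∨

T-∨false⁻ : ∀ {x} → T (x ∨ false) → T x
T-∨false⁻ {true} _ = tt

T-nand⁻ : ∀ {x y} → T (not (x ∧ y)) → T x → T y → ⊥
T-nand⁻ h p q = T-not⁻ h (T-∧⁺ p q)

T-nand⁺ : ∀ {x y} → (T x → T y → ⊥) → T (not (x ∧ y))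
T-nand⁺ {false}        _ = tt
T-nand⁺ {true} {false} _ = tt
T-nand⁺ {true} {true}  h = h tt tt

true≢false : true ≢ false
true≢false ()

≟-cancelʳ : ∀ x x' y → ⌊ x Bool.≟ x' ⌋ ≡ ⌊ y Bool.≟ x' ⌋ → x ≡ y
≟-cancelʳ true  true  true  _ = refl
≟-cancelʳ true  true  false ()
≟-cancelʳ false true  true  ()
≟-cancelʳ false true  false _ = refl
≟-cancelʳ true  false true  _ = refl
≟-cancelʳ true  false false ()
≟-cancelʳ false false true  ()
≟-cancelʳ false false false _ = refl

≟-cancelʳ-not : ∀ x x' y → ⌊ x Bool.≟ x' ⌋ ≡ ⌊ y Bool.≟ not x' ⌋ → not x ≡ y
≟-cancelʳ-not true  true  true  ()
≟-cancelʳ-not true  true  false _ = refl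
≟-cancelʳ-not false true  true  _ = refl
≟-cancelʳ-not false true  false ()
≟-cancelʳ-not true  false true  ()
≟-cancelʳ-not true  false false _ = refl
≟-cancelʳ-not false false true  _ = refl
≟-cancelʳ-not false false false ()

<ᵇ-suc : ∀ m n → (m <ᵇ suc n) ≡ not (n <ᵇ m)
<ᵇ-suc zero    n       = refl
<ᵇ-suc (suc m) zero    = refl
<ᵇ-suc (suc m) (suc n) = <ᵇ-suc m n

module _ {n : ℕ} (p : Fin n → Bool) where

  allF⁺ : (∀ i → T (p i)) → T (allF n p)
  allF⁺ h = all⁻ p {xs = allFin n} (All.tabulate (λ {i} _ → h i))

  allF⁻ : T (allF n p) → ∀ i → T (p i)
  allF⁻ h i = All.lookup (all⁺ p (allFin n) h) (∈-allFin i)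

  anyF⁺ : ∀ i → T (p i) → T (anyF n p)
  anyF⁺ i h = any⁺ p (lose (∈-allFin i) h)

  anyF⁻ : T (anyF n p) → ∃ λ i → T (p i)
  anyF⁻ h = satisfied (any⁻ p (allFin n) h)

  allF-¬ : ¬ T (allF n p) → ∃ λ i → ¬ T (p i)
  allF-¬ h = ¬∀⟶∃¬ n (T ∘ p) (T? ∘ p) (h ∘ allF⁺)

-- Counting edges

indicator : Bool → ℕ
indicator true  = 1
indicator false = 0

count : {A : Set} → (A → Bool) → List A → ℕ
count p xs = length (filterᵇ p xs)

module _ {A : Set} where

  count-∷ : ∀ (p : A → Bool) x xs → count p (x ∷ xs) ≡ indicator (p x) + count p xs
  count-∷ p x xs with p x
  ... | true  = refl
  ... | false = refl

  count-cong : ∀ {p q : A → Bool} → (∀ x → p x ≡ q x) → ∀ xs → count p xs ≡ count q xs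
  count-cong p≗q []       = refl
  count-cong {p} {q} p≗q (x ∷ xs) = begin
    count p (x ∷ xs)                ≡⟨ count-∷ p x xs ⟩
    indicator (p x) + count p xs    ≡⟨ cong₂ _+_ (cong indicator (p≗q x)) (count-cong p≗q xs) ⟩
    indicator (q x) + count q xs    ≡⟨ count-∷ q x xs ⟨
    count q (x ∷ xs)                ∎
    where open ≡-Reasoning

  count-++ : ∀ (p : A → Bool) xs ys → count p (xs ++ ys) ≡ count p xs + count p ys
  count-++ p xs ys = trans (cong length (filter-++ (T? ∘ p) xs ys)) (length-++ (filterᵇ p xs))

  count-↭ : ∀ (p : A → Bool) {xs ys} → xs ↭ ys → count p xs ≡ count p ys
  count-↭ p xs↭ys = ↭-length (filter-↭ (T? ∘ p) xs↭ys)

  count-false : ∀ xs → count {A} (λ _ → false) xs ≡ 0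
  count-false []       = refl
  count-false (_ ∷ xs) = count-false xs

  count-true : ∀ xs → count {A} (λ _ → true) xs ≡ length xs
  count-true []       = refl
  count-true (_ ∷ xs) = cong suc (count-true xs)

  count-∨ : ∀ (p q : A → Bool) → (∀ x → ¬ (T (p x) × T (q x))) → ∀ xs →
    count (λ x → p x ∨ q x) xs ≡ count p xs + count q xs
  count-∨ p q disjoint [] = refl
  count-∨ p q disjoint (x ∷ xs) = begin
    count (λ x → p x ∨ q x) (x ∷ xs)
      ≡⟨ count-∷ _ x xs ⟩
    indicator (p x ∨ q x) + count (λ x → p x ∨ q x) xs
      ≡⟨ cong₂ _+_ (indicator-∨ (p x) (q x) (disjoint x)) (count-∨ p q disjoint xs) ⟩
    (indicator (p x) + indicator (q x)) + (count p xs + count q xs)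
      ≡⟨ interchange (indicator (p x)) (indicator (q x)) (count p xs) (count q xs) ⟩
    (indicator (p x) + count p xs) + (indicator (q x) + count q xs)
      ≡⟨ cong₂ _+_ (count-∷ p x xs) (count-∷ q x xs) ⟨
    count p (x ∷ xs) + count q (x ∷ xs)
      ∎
    where
    open ≡-Reasoning
    indicator-∨ : ∀ a b → ¬ (T a × T b) → indicator (a ∨ b) ≡ indicator a + indicator b
    indicator-∨ true  true  ¬both = ⊥-elim (¬both (tt , tt))
    indicator-∨ true  false _     = refl
    indicator-∨ false _     _     = refl

count-map : ∀ {A B : Set} (p : B → Bool) (f : A → B) xs → count p (map f xs) ≡ count (p ∘ f) xs
count-map p f []       = refl
count-map p f (x ∷ xs) = begin
  count p (f x ∷ map f xs)                 ≡⟨ count-∷ p (f x) (map f xs) ⟩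
  indicator (p (f x)) + count p (map f xs) ≡⟨ cong (indicator (p (f x)) +_) (count-map p f xs) ⟩
  indicator (p (f x)) + count (p ∘ f) xs   ≡⟨ count-∷ (p ∘ f) x xs ⟨
  count (p ∘ f) (x ∷ xs)                   ∎
  where open ≡-Reasoning

module _ {A : Set} where

  sum-map-+ : ∀ (f g : A → ℕ) xs →
    sum (map (λ x → f x + g x) xs) ≡ sum (map f xs) + sum (map g xs)
  sum-map-+ f g []       = refl
  sum-map-+ f g (x ∷ xs) = trans (cong (f x + g x +_) (sum-map-+ f g xs))
    (interchange (f x) (g x) (sum (map f xs)) (sum (map g xs)))

  sum-map-indicator : ∀ (p : A → Bool) xs → sum (map (indicator ∘ p) xs) ≡ count p xs
  sum-map-indicator p []       = refl
  sum-map-indicator p (x ∷ xs) =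
    trans (cong (indicator (p x) +_) (sum-map-indicator p xs)) (sym (count-∷ p x xs))

  sum-map-const : ∀ d (xs : List A) → sum (map (λ _ → d) xs) ≡ length xs * d
  sum-map-const d []       = refl
  sum-map-const d (x ∷ xs) = cong (d +_) (sum-map-const d xs)

  sum-map-cong : ∀ {f g : A → ℕ} → (∀ x → f x ≡ g x) → ∀ xs →
    sum (map f xs) ≡ sum (map g xs)
  sum-map-cong f≗g xs = cong sum (map-cong f≗g xs)

module _ {A : Set} (adj : A → A → Bool) where

  crossEdges : List A → List A → ℕ
  crossEdges xs ys = sum (map (λ x → count (adj x) ys) xs)

  countEdges-++ : ∀ xs ys →
    countEdges adj (xs ++ ys) ≡ countEdges adj xs + countEdges adj ys + crossEdges xs ys
  countEdges-++ []       ys = sym (+-identityʳ (countEdges adj ys))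
  countEdges-++ (x ∷ xs) ys = trans
    (cong₂ _+_ (count-++ (adj x) xs ys) (countEdges-++ xs ys))
    (rearrange (count (adj x) xs) (count (adj x) ys)
               (countEdges adj xs) (countEdges adj ys) (crossEdges xs ys))
    where
    rearrange : ∀ p q r s t → (p + q) + ((r + s) + t) ≡ ((p + r) + s) + (q + t)
    rearrange = solve 5 (λ p q r s t → (p :+ q) :+ ((r :+ s) :+ t) := ((p :+ r) :+ s) :+ (q :+ t)) refl

  module _ (adj-sym : ∀ x y → adj x y ≡ adj y x) where

    countEdges-↭ : ∀ {xs ys} → xs ↭ ys → countEdges adj xs ≡ countEdges adj ys
    countEdges-↭ ↭-refl = refl
    countEdges-↭ (prep x p) = cong₂ _+_ (count-↭ (adj x) p) (countEdges-↭ p)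
    countEdges-↭ (↭-trans p q) = trans (countEdges-↭ p) (countEdges-↭ q)
    countEdges-↭ {x ∷ y ∷ xs} {.y ∷ .x ∷ ys} (swap x y p) = begin
      count (adj x) (y ∷ xs) + (count (adj y) xs + countEdges adj xs)
        ≡⟨ cong (_+ _) (count-∷ (adj x) y xs) ⟩
      (indicator (adj x y) + count (adj x) xs) + (count (adj y) xs + countEdges adj xs)
        ≡⟨ cong₂ (λ e c → (indicator e + c) + (count (adj y) xs + countEdges adj xs))
                 (adj-sym x y) (count-↭ (adj x) p) ⟩
      (indicator (adj y x) + count (adj x) ys) + (count (adj y) xs + countEdges adj xs)
        ≡⟨ cong₂ (λ c e → (indicator (adj y x) + count (adj x) ys) + (c + e))
                 (count-↭ (adj y) p) (countEdges-↭ p) ⟩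
      (indicator (adj y x) + count (adj x) ys) + (count (adj y) ys + countEdges adj ys)
        ≡⟨ interchange (indicator (adj y x)) (count (adj x) ys) (count (adj y) ys) (countEdges adj ys) ⟩
      (indicator (adj y x) + count (adj y) ys) + (count (adj x) ys + countEdges adj ys)
        ≡⟨ cong (_+ _) (count-∷ (adj y) x ys) ⟨
      count (adj y) (x ∷ ys) + (count (adj x) ys + countEdges adj ys)
        ∎
      where open ≡-Reasoning

    handshake : (∀ x → adj x x ≡ false) → ∀ xs →
      2 * countEdges adj xs ≡ sum (map (λ x → count (adj x) xs) xs)
    handshake irrefl []       = refl
    handshake irrefl (y ∷ xs) = sym (begin
      sum (map (λ x → count (adj x) (y ∷ xs)) (y ∷ xs))
        ≡⟨ cong₂ _+_ (trans (count-∷ (adj y) y xs) (cong (λ e → indicator e + degy) (irrefl y)))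
                     (sum-map-cong (λ x → count-∷ (adj x) y xs) xs) ⟩
      degy + sum (map (λ x → indicator (adj x y) + count (adj x) xs) xs)
        ≡⟨ cong (degy +_) (sum-map-+ (λ x → indicator (adj x y)) (λ x → count (adj x) xs) xs) ⟩
      degy + (sum (map (λ x → indicator (adj x y)) xs) + sum (map (λ x → count (adj x) xs) xs))
        ≡⟨ cong₂ (λ d s → degy + (d + s)) toY (sym (handshake irrefl xs)) ⟩
      degy + (degy + 2 * countEdges adj xs)
        ≡⟨ double degy (countEdges adj xs) ⟨
      2 * (degy + countEdges adj xs)
        ∎)
      where
      open ≡-Reasoning
      degy : ℕ
      degy = count (adj y) xs
      toY : sum (map (λ x → indicator (adj x y)) xs) ≡ degy
      toY = trans (sum-map-indicator (λ x → adj x y) xs) (count-cong (λ x → adj-sym x y) xs)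
      double : ∀ d e → 2 * (d + e) ≡ d + (d + 2 * e)
      double = solve 2 (λ d e → con 2 :* (d :+ e) := d :+ (d :+ con 2 :* e)) refl

    countEdges-regular : (∀ x → adj x x ≡ false) → ∀ {d} xs →
      (∀ x → count (adj x) xs ≡ d) →
      2 * countEdges adj xs ≡ length xs * d
    countEdges-regular irrefl {d} xs degree =
      trans (handshake irrefl xs) (trans (sum-map-cong degree xs) (sum-map-const d xs))

  countEdges-cong : ∀ {adj' : A → A → Bool} → (∀ x y → adj x y ≡ adj' x y) → ∀ xs →
    countEdges adj xs ≡ countEdges adj' xs
  countEdges-cong adj≗adj' []       = refl
  countEdges-cong adj≗adj' (x ∷ xs) =
    cong₂ _+_ (count-cong (adj≗adj' x) xs) (countEdges-cong adj≗adj' xs)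

countEdges-map : ∀ {A B : Set} (adj : B → B → Bool) (f : A → B) xs →
  countEdges adj (map f xs) ≡ countEdges (λ x y → adj (f x) (f y)) xs
countEdges-map adj f []       = refl
countEdges-map adj f (x ∷ xs) = cong₂ _+_ (count-map (adj (f x)) f xs) (countEdges-map adj f xs)

lookup-injective : ∀ {A : Set} {xs : List A} → Unique xs → Injective _≡_ _≡_ (lookup xs)
lookup-injective (_ ∷ _)     {zero}  {zero}  _ = refl
lookup-injective (x∉xs ∷ _)  {zero}  {suc q} e = ⊥-elim (All.lookup x∉xs (∈-lookup q) e)
lookup-injective (x∉xs ∷ _)  {suc p} {zero}  e = ⊥-elim (All.lookup x∉xs (∈-lookup p) (sym e))
lookup-injective (_ ∷ uniq)  {suc p} {suc q} e = cong suc (lookup-injective uniq e)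

↭-from-∈ : ∀ {A : Set} {xs ys : List A} → Unique xs → Unique ys →
  (∀ {x} → x ∈ xs → x ∈ ys) → (∀ {x} → x ∈ ys → x ∈ xs) → xs ↭ ys
↭-from-∈ uniq-xs uniq-ys to from = ∼bag⇒↭ (unique∧set⇒bag uniq-xs uniq-ys (mk⇔ to from))

count-≟-unique : ∀ {A : Set} (_≟ᴬ_ : DecidableEquality A) {x : A} {ys} → Unique ys → x ∈ ys →
  count (λ y → ⌊ x ≟ᴬ y ⌋) ys ≡ 1
count-≟-unique _≟ᴬ_ {x} {y ∷ ys} (y∉ys ∷ uniq) x∈y∷ys with x ≟ᴬ y | x∈y∷ys
... | yes refl | _          =
  cong (suc ∘ length) (filter-none (T? ∘ λ z → ⌊ x ≟ᴬ z ⌋) (All.map (_∘ toWitness) y∉ys))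
... | no x≢y   | here x≡y   = ⊥-elim (x≢y x≡y)
... | no _     | there x∈ys = count-≟-unique _≟ᴬ_ uniq x∈ys

bools : List Bool
bools = true ∷ false ∷ []

bools-unique : Unique bools
bools-unique = ((λ ()) ∷ []) ∷ [] ∷ []

∈-bools : ∀ x → x ∈ bools
∈-bools true  = here refl
∈-bools false = there (here refl)

module _ {A : Set} (xs : List A) where

  private
    concatMap-cartesian : ∀ {m} (vs : List (Vec A m)) →
      concatMap (λ v → map (λ x → x ∷ᵛ v) xs) vs
        ≡ cartesianProductWith (λ v x → x ∷ᵛ v) vs xs
    concatMap-cartesian []       = refl
    concatMap-cartesian (v ∷ vs) = cong (map (λ x → x ∷ᵛ v) xs ++_) (concatMap-cartesian vs)

  allVecs-unique : Unique xs → ∀ m → Unique (allVecs xs m)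
  allVecs-unique uniq zero    = [] ∷ []
  allVecs-unique uniq (suc m) = subst Unique (sym (concatMap-cartesian (allVecs xs m)))
    (Unique.cartesianProductWith⁺ (λ v x → x ∷ᵛ v) (Product.swap ∘ ∷-injective)
                                  (allVecs-unique uniq m) uniq)

  ∈-allVecs : (∀ x → x ∈ xs) → ∀ {m} (v : Vec A m) → v ∈ allVecs xs m
  ∈-allVecs ∈xs []ᵛ       = here refl
  ∈-allVecs ∈xs (x ∷ᵛ v) =
    ∈-concat⁺′ (∈-map⁺ (λ y → y ∷ᵛ v) (∈xs x))
               (∈-map⁺ (λ w → map (λ y → y ∷ᵛ w) xs) (∈-allVecs ∈xs v))

allRels-unique : ∀ n → Unique (allRels n)
allRels-unique n = allVecs-unique _ (allVecs-unique _ bools-unique n) n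

∈-allRels : ∀ {n} (R : Rel n) → R ∈ allRels n
∈-allRels = ∈-allVecs _ (∈-allVecs _ ∈-bools)

-- Stable partitions as proper colourings

lookup-ext : ∀ {A : Set} {m} {u v : Vec A m} → (∀ i → Vec.lookup u i ≡ Vec.lookup v i) → u ≡ v
lookup-ext {u = u} {v} h =
  trans (sym (tabulate∘lookup u)) (trans (tabulate-cong h) (tabulate∘lookup v))

rel-ext : ∀ {n} {R S : Rel n} → (∀ i j → rel R i j ≡ rel S i j) → R ≡ S
rel-ext h = lookup-ext (λ i → lookup-ext (h i))

kernel : ∀ {n k} → (Fin n → Fin k) → Rel n
kernel c = tabulate (λ i → tabulate (λ j → ⌊ c i ≟ c j ⌋))

rel-kernel : ∀ {n k} (c : Fin n → Fin k) i j → rel (kernel c) i j ≡ ⌊ c i ≟ c j ⌋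
rel-kernel c i j rewrite lookup∘tabulate (λ i → tabulate (λ j → ⌊ c i ≟ c j ⌋)) i =
  lookup∘tabulate (λ j → ⌊ c i ≟ c j ⌋) j

Proper : ∀ {n k} → Graph n → (Fin n → Fin k) → Set
Proper G c = ∀ i j → T (G i j) → c i ≢ c j

SameBlock : ∀ {n} → Rel n → Fin n → Fin n → Set
SameBlock R i j = T (rel R i j)

module _ {n : ℕ} (R : Rel n) where

  private
    isRefl : Fin n → Bool
    isRefl i = rel R i i
    isSym : Fin n → Fin n → Bool
    isSym i j = not (rel R i j) ∨ rel R j i
    isTrans : Fin n → Fin n → Fin n → Bool
    isTrans i j k = not (rel R i j ∧ rel R j k) ∨ rel R i k

  isEquivalence⁻ : T (isEquivalence n R) → IsEquivalence (SameBlock R)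
  isEquivalence⁻ h = record
    { refl  = λ {i} → allF⁻ isRefl r i
    ; sym   = λ {i} {j} → T-⇒⁻ (allF⁻ (isSym i) (allF⁻ _ s i) j)
    ; trans = λ {i} {j} {k} p q →
        T-⇒⁻ (allF⁻ (isTrans i j) (allF⁻ _ (allF⁻ _ t i) j) k) (T-∧⁺ p q)
    }
    where
    r : T (allF n isRefl)
    r = proj₁ (T-∧⁻ h)
    s : T (allF n (λ i → allF n (isSym i)))
    s = proj₁ (T-∧⁻ (proj₂ (T-∧⁻ {allF n isRefl} h)))
    t : T (allF n (λ i → allF n (λ j → allF n (isTrans i j))))
    t = proj₂ (T-∧⁻ (proj₂ (T-∧⁻ {allF n isRefl} h)))

  isEquivalence⁺ : IsEquivalence (SameBlock R) → T (isEquivalence n R)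
  isEquivalence⁺ eq = T-∧⁺ (allF⁺ isRefl (λ _ → ~-refl)) (T-∧⁺
    (allF⁺ _ (λ i → allF⁺ (isSym i) (λ j → T-⇒⁺ ~-sym)))
    (allF⁺ _ (λ i → allF⁺ _ (λ j → allF⁺ (isTrans i j) (λ k → T-⇒⁺ (λ h →
      let ij , jk = T-∧⁻ {rel R i j} h in ~-trans ij jk))))))
    where open IsEquivalence eq renaming (refl to ~-refl; sym to ~-sym; trans to ~-trans)

Independent : ∀ {n} → Graph n → Rel n → Set
Independent G R = ∀ i j → T (G i j) → ¬ T (rel R i j)

module _ {n k : ℕ} (G : Graph n) (R : Rel n) where

  private
    isolated : Fin n → Fin n → Bool
    isolated i j = not (G i j ∧ rel R i j)

  isStablePartition⁻ : T (isStablePartition n k G R) →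
    IsEquivalence (SameBlock R) × numParts n R ≤ k × Independent G R
  isStablePartition⁻ h =
    let equiv , rest = T-∧⁻ h ; bound , independent = T-∧⁻ {numParts n R ≤ᵇ k} rest
    in isEquivalence⁻ R equiv , ≤ᵇ⇒≤ (numParts n R) k bound ,
       λ i j g → T-nand⁻ (allF⁻ (isolated i) (allF⁻ _ independent i) j) g

  isStablePartition⁺ : IsEquivalence (SameBlock R) → numParts n R ≤ k → Independent G R →
    T (isStablePartition n k G R)
  isStablePartition⁺ equiv bound independent =
    T-∧⁺ (isEquivalence⁺ R equiv) (T-∧⁺ (≤⇒≤ᵇ bound)
      (allF⁺ _ (λ i → allF⁺ (isolated i) (λ j → T-nand⁺ (independent i j)))))

isLeast : ∀ n → Rel n → Fin n → Bool
isLeast n R i = not (anyF n (λ j → ltF j i ∧ rel R i j))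

leaders : ∀ n → Rel n → List (Fin n)
leaders n R = filterᵇ (isLeast n R) (allFin n)

least-minimal : ∀ {n} (R : Rel n) {i j} → T (isLeast n R i) → j < i → ¬ T (rel R i j)
least-minimal {n} R {i} {j} l j<i i~j =
  T-not⁻ l (anyF⁺ (λ j → ltF j i ∧ rel R i j) j (T-∧⁺ (fromWitness j<i) i~j))

leaders-unique : ∀ {n} (R : Rel n) → Unique (leaders n R)
leaders-unique {n} R = Unique.filter⁺ (T? ∘ isLeast n R) (Unique.allFin⁺ n)

∈-leaders : ∀ {n} (R : Rel n) {i} → T (isLeast n R i) → i ∈ leaders n R
∈-leaders {n} R l = ∈-filter⁺ (T? ∘ isLeast n R) (∈-allFin _) l

module EquivalenceClasses {n : ℕ} (R : Rel n) (equiv : IsEquivalence (SameBlock R)) where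

  open IsEquivalence equiv renaming (refl to ~-refl; sym to ~-sym; trans to ~-trans)

  _~_ : Fin n → Fin n → Set
  _~_ = SameBlock R

  leaders-related⇒≡ : ∀ {r r'} → T (isLeast n R r) → T (isLeast n R r') → r ~ r' → r ≡ r'
  leaders-related⇒≡ {r} {r'} l l' r~r' with <-cmp r r'
  ... | tri< r<r' _ _ = ⊥-elim (least-minimal R l' r<r' (~-sym r~r'))
  ... | tri≈ _ r≡r' _ = r≡r'
  ... | tri> _ _ r'<r = ⊥-elim (least-minimal R l r'<r r~r')

  leaderOf : ∀ i → Acc _<_ i → ∃ λ r → T (isLeast n R r) × i ~ r
  leaderOf i (acc smaller) with T? (isLeast n R i)
  ... | yes l = i , l , ~-refl
  ... | no ¬l with anyF⁻ (λ j → ltF j i ∧ rel R i j) (¬T-not ¬l)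
  ...   | j , j<i∧i~j with T-∧⁻ j<i∧i~j
  ...     | j<i , i~j with leaderOf j (smaller (toWitness j<i))
  ...       | r , l , j~r = r , l , ~-trans i~j j~r

  leader : Fin n → Fin n
  leader i = proj₁ (leaderOf i (<-wellFounded i))

  leader-least : ∀ i → T (isLeast n R (leader i))
  leader-least i = proj₁ (proj₂ (leaderOf i (<-wellFounded i)))

  ~leader : ∀ i → i ~ leader i
  ~leader i = proj₂ (proj₂ (leaderOf i (<-wellFounded i)))

  position : ∀ r → T (isLeast n R r) → Fin (numParts n R)
  position r l = index (∈-leaders R l)

  position-cong : ∀ {r r'} (l : T (isLeast n R r)) (l' : T (isLeast n R r')) →
    r ≡ r' → position r l ≡ position r' l'
  position-cong l l' refl = cong (position _) (T-irrelevant l l')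

  block : Fin n → Fin (numParts n R)
  block i = position (leader i) (leader-least i)

  ~⇒block≡ : ∀ {i j} → i ~ j → block i ≡ block j
  ~⇒block≡ {i} {j} i~j = position-cong (leader-least i) (leader-least j)
    (leaders-related⇒≡ (leader-least i) (leader-least j)
      (~-trans (~-sym (~leader i)) (~-trans i~j (~leader j))))

  block≡⇒~ : ∀ {i j} → block i ≡ block j → i ~ j
  block≡⇒~ {i} {j} e = ~-trans (~leader i) (subst (λ r → r ~ j) (sym leader≡) (~-sym (~leader j)))
    where
    leader≡ : leader i ≡ leader j
    leader≡ = trans (lookup-index (∈-leaders R (leader-least i)))
      (trans (cong (lookup (leaders n R)) e) (sym (lookup-index (∈-leaders R (leader-least j)))))

stable⇒kernel : ∀ {n k} (G : Graph n) (R : Rel n) → T (isStablePartition n k G R) →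
  ∃ λ (c : Fin n → Fin k) → Proper G c × R ≡ kernel c
stable⇒kernel {n} {k} G R stable =
  c , proper , rel-ext (λ i j → trans (rel≡ i j) (sym (rel-kernel c i j)))
  where
  parts : IsEquivalence (SameBlock R) × numParts n R ≤ k × Independent G R
  parts = isStablePartition⁻ G R stable
  bound : numParts n R ≤ k
  bound = proj₁ (proj₂ parts)
  open EquivalenceClasses R (proj₁ parts)

  c : Fin n → Fin k
  c i = inject≤ (block i) bound

  rel≡ : ∀ i j → rel R i j ≡ ⌊ c i ≟ c j ⌋
  rel≡ i j = T-ext (λ i~j → fromWitness (cong (λ p → inject≤ p bound) (~⇒block≡ i~j)))
                   (λ e → block≡⇒~ (inject≤-injective _ _ _ _ (toWitness e)))

  proper : Proper G c
  proper i j g e = proj₂ (proj₂ parts) i j g (subst T (sym (rel≡ i j)) (fromWitness e))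

module _ {n k : ℕ} (c : Fin n → Fin k) where

  kernel⁺ : ∀ {i j} → c i ≡ c j → T (rel (kernel c) i j)
  kernel⁺ {i} {j} e = subst T (sym (rel-kernel c i j)) (fromWitness e)

  kernel⁻ : ∀ {i j} → T (rel (kernel c) i j) → c i ≡ c j
  kernel⁻ {i} {j} h = toWitness (subst T (rel-kernel c i j) h)

  kernel-equivalence : IsEquivalence (SameBlock (kernel c))
  kernel-equivalence = record
    { refl  = kernel⁺ refl
    ; sym   = kernel⁺ ∘ sym ∘ kernel⁻
    ; trans = λ p q → kernel⁺ (trans (kernel⁻ p) (kernel⁻ q))
    }

  kernel-numParts : numParts n (kernel c) ≤ k
  kernel-numParts = injective⇒≤ {f = c ∘ lookup L} (λ e →
    lookup-injective (leaders-unique K) (leaders-related⇒≡ (isLeader _) (isLeader _) (kernel⁺ e)))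
    where
    K : Rel n
    K = kernel c
    L : List (Fin n)
    L = leaders n K
    open EquivalenceClasses K kernel-equivalence
    isLeader : ∀ p → T (isLeast n K (lookup L p))
    isLeader p = proj₂ (∈-filter⁻ (T? ∘ isLeast n K) {xs = allFin n} (∈-lookup p))

kernel-stable : ∀ {n k} (G : Graph n) (c : Fin n → Fin k) → Proper G c →
  T (isStablePartition n k G (kernel c))
kernel-stable G c proper = isStablePartition⁺ G (kernel c) (kernel-equivalence c) (kernel-numParts c)
  (λ i j g → proper i j g ∘ kernel⁻ c)

-- Adjacency in the reconfiguration graph

-- sameRel compares entries by a function local to Defs; entries are inspected by cases instead.
sameRel⁻ : ∀ {n} (P Q : Rel n) → T (sameRel n P Q) → P ≡ Q
sameRel⁻ {n} P Q h = rel-ext pointwise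
  where
  pointwise : ∀ i j → rel P i j ≡ rel Q i j
  pointwise i j with rel P i j | rel Q i j | allF⁻ _ (allF⁻ _ h i) j
  ... | true  | true  | _ = refl
  ... | false | false | _ = refl

sameRel-≢ : ∀ {n} (P Q : Rel n) → ¬ T (sameRel n P Q) → P ≢ Q
sameRel-≢ {n} P .P h refl with allF-¬ _ h
... | i , ¬row with allF-¬ _ ¬row
... | j , ¬entry with rel P i j | ¬entry
... | true  | ¬same = ¬same tt
... | false | ¬same = ¬same tt

record AgreeOff {n} (P Q : Rel n) (v : Fin n) : Set where
  constructor agreeing
  field agreement : ∀ i j → i ≢ v → j ≢ v → rel P i j ≡ rel Q i j

open AgreeOff

module _ {n : ℕ} (P Q : Rel n) (v : Fin n) where

  private
    entry : Fin n → Fin n → Bool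
    entry i j =
      eqF i v ∨ eqF j v ∨ ((rel P i j ∧ rel Q i j) ∨ (not (rel P i j) ∧ not (rel Q i j)))

  agreeOff⁺ : AgreeOff P Q v → T (agreeOff n P Q v)
  agreeOff⁺ agree = allF⁺ _ (λ i → allF⁺ (entry i) (λ j → entry⁺ i j))
    where
    entry⁺ : ∀ i j → T (entry i j)
    entry⁺ i j with i ≟ v | j ≟ v
    ... | yes _ | _     = tt
    ... | no _  | yes _ = tt
    ... | no i≢v | no j≢v rewrite agreement agree i j i≢v j≢v with rel Q i j
    ...   | true  = tt
    ...   | false = tt

  agreeOff⁻ : T (agreeOff n P Q v) → AgreeOff P Q v
  agreeOff⁻ h = agreeing pointwise
    where
    pointwise : ∀ i j → i ≢ v → j ≢ v → rel P i j ≡ rel Q i j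
    pointwise i j i≢v j≢v with allF⁻ (entry i) (allF⁻ _ h i) j
    ... | h' rewrite dec-no (i ≟ v) i≢v | dec-no (j ≟ v) j≢v with rel P i j | rel Q i j | h'
    ...   | true  | true  | _ = refl
    ...   | false | false | _ = refl

AgreeOff-sym : ∀ {n} {P Q : Rel n} {v} → AgreeOff P Q v → AgreeOff Q P v
AgreeOff-sym agree = agreeing (λ i j i≢v j≢v → sym (agreement agree i j i≢v j≢v))

Adjacent : ∀ {n} → Rel n → Rel n → Set
Adjacent P Q = P ≢ Q × ∃ (AgreeOff P Q)

Adjacent-sym : ∀ {n} {P Q : Rel n} → Adjacent P Q → Adjacent Q P
Adjacent-sym (P≢Q , v , agree) = P≢Q ∘ sym , v , AgreeOff-sym agree

reconfAdj⁺ : ∀ {n} (P Q : Rel n) → Adjacent P Q → T (reconfAdj n P Q)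
reconfAdj⁺ {n} P Q (P≢Q , v , agree) =
  T-∧⁺ (T-not⁺ (P≢Q ∘ sameRel⁻ P Q)) (anyF⁺ (agreeOff n P Q) v (agreeOff⁺ P Q v agree))

reconfAdj⁻ : ∀ {n} (P Q : Rel n) → T (reconfAdj n P Q) → Adjacent P Q
reconfAdj⁻ {n} P Q h with T-∧⁻ {not (sameRel n P Q)} h
... | different , someVertex with anyF⁻ (agreeOff n P Q) someVertex
...   | v , agree = sameRel-≢ P Q (T-not⁻ different) , v , agreeOff⁻ P Q v agree

reconfAdj-sym : ∀ {n} (P Q : Rel n) → reconfAdj n P Q ≡ reconfAdj n Q P
reconfAdj-sym P Q = T-ext (reconfAdj⁺ Q P ∘ Adjacent-sym ∘ reconfAdj⁻ P Q)
                          (reconfAdj⁺ P Q ∘ Adjacent-sym ∘ reconfAdj⁻ Q P)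

⌊≟⌋-injective : ∀ {k l} {f : Fin k → Fin l} → Injective _≡_ _≡_ f →
  ∀ x y → ⌊ f x ≟ f y ⌋ ≡ ⌊ x ≟ y ⌋
⌊≟⌋-injective {f = f} inj x y =
  T-ext (fromWitness ∘ inj ∘ toWitness) (fromWitness ∘ cong f ∘ toWitness)

module _ {n k : ℕ} {c c' : Fin n → Fin k} (f : Fin k → Fin k) (f-injective : Injective _≡_ _≡_ f)
  where

  rel-kernel-rename : ∀ {i j} → f (c i) ≡ c' i → f (c j) ≡ c' j →
    rel (kernel c) i j ≡ rel (kernel c') i j
  rel-kernel-rename {i} {j} ci cj = begin
    rel (kernel c) i j        ≡⟨ rel-kernel c i j ⟩
    ⌊ c i ≟ c j ⌋             ≡⟨ ⌊≟⌋-injective f-injective (c i) (c j) ⟨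
    ⌊ f (c i) ≟ f (c j) ⌋     ≡⟨ cong₂ (λ x y → ⌊ x ≟ y ⌋) ci cj ⟩
    ⌊ c' i ≟ c' j ⌋           ≡⟨ rel-kernel c' i j ⟨
    rel (kernel c') i j       ∎
    where open ≡-Reasoning

  kernel-rename : (∀ i → f (c i) ≡ c' i) → kernel c ≡ kernel c'
  kernel-rename renamed = rel-ext (λ i j → rel-kernel-rename (renamed i) (renamed j))

  kernel-agreeOff : ∀ {v} → (∀ i → i ≢ v → f (c i) ≡ c' i) → AgreeOff (kernel c) (kernel c') v
  kernel-agreeOff renamed =
    agreeing (λ i j i≢v j≢v → rel-kernel-rename (renamed i i≢v) (renamed j j≢v))

-- Bit vectors

bitVecs : ∀ m → List (Vec Bool m)
bitVecs = allVecs bools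

bitVecs-unique : ∀ m → Unique (bitVecs m)
bitVecs-unique = allVecs-unique bools bools-unique

∈-bitVecs : ∀ {m} (X : Vec Bool m) → X ∈ bitVecs m
∈-bitVecs = ∈-allVecs bools ∈-bools

count-bitVecs-suc : ∀ {m} (p : Vec Bool (suc m) → Bool) →
  count p (bitVecs (suc m))
    ≡ count (p ∘ (true ∷ᵛ_)) (bitVecs m) + count (p ∘ (false ∷ᵛ_)) (bitVecs m)
count-bitVecs-suc {m} p = go (bitVecs m)
  where
  pt pf : Vec Bool m → Bool
  pt = p ∘ (true ∷ᵛ_)
  pf = p ∘ (false ∷ᵛ_)

  go : ∀ Xs → count p (concatMap (λ X → map (_∷ᵛ X) bools) Xs) ≡ count pt Xs + count pf Xs
  go []       = refl
  go (X ∷ Xs) = begin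
    count p ((true ∷ᵛ X) ∷ (false ∷ᵛ X) ∷ rest)
      ≡⟨ trans (count-∷ p _ _) (cong (indicator (pt X) +_) (count-∷ p _ rest)) ⟩
    indicator (pt X) + (indicator (pf X) + count p rest)
      ≡⟨ cong (λ c → indicator (pt X) + (indicator (pf X) + c)) (go Xs) ⟩
    indicator (pt X) + (indicator (pf X) + (count pt Xs + count pf Xs))
      ≡⟨ rearrange (indicator (pt X)) (indicator (pf X)) (count pt Xs) (count pf Xs) ⟩
    (indicator (pt X) + count pt Xs) + (indicator (pf X) + count pf Xs)
      ≡⟨ cong₂ _+_ (count-∷ pt X Xs) (count-∷ pf X Xs) ⟨
    count pt (X ∷ Xs) + count pf (X ∷ Xs)
      ∎
    where
    open ≡-Reasoning
    rest : List (Vec Bool (suc m))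
    rest = concatMap (λ X → map (_∷ᵛ X) bools) Xs
    rearrange : ∀ a b c d → a + (b + (c + d)) ≡ (a + c) + (b + d)
    rearrange = solve 4 (λ a b c d → a :+ (b :+ (c :+ d)) := (a :+ c) :+ (b :+ d)) refl

length-bitVecs : ∀ m → length (bitVecs m) ≡ 2 ^ m
length-bitVecs zero    = refl
length-bitVecs (suc m) = begin
  length (bitVecs (suc m))                  ≡⟨ count-true (bitVecs (suc m)) ⟨
  count (λ _ → true) (bitVecs (suc m))      ≡⟨ count-bitVecs-suc {m} (λ _ → true) ⟩
  count (λ _ → true) (bitVecs m) + count (λ _ → true) (bitVecs m)
                                            ≡⟨ cong₂ _+_ half half ⟩
  2 ^ m + 2 ^ m                             ≡⟨ cong (2 ^ m +_) (+-identityʳ (2 ^ m)) ⟨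
  2 ^ suc m                                 ∎
  where
  open ≡-Reasoning
  half : count (λ _ → true) (bitVecs m) ≡ 2 ^ m
  half = trans (count-true (bitVecs m)) (length-bitVecs m)

_≟ᵇ_ : ∀ {m} → DecidableEquality (Vec Bool m)
_≟ᵇ_ = ≡-dec Bool._≟_

count-≟ᵇ : ∀ {m} (X : Vec Bool m) → count (λ Y → ⌊ X ≟ᵇ Y ⌋) (bitVecs m) ≡ 1
count-≟ᵇ X = count-≟-unique _≟ᵇ_ (bitVecs-unique _) (∈-bitVecs X)

count-≟ᵇ-∧ : ∀ {m} (X : Vec Bool m) t →
  count (λ Y → ⌊ X ≟ᵇ Y ⌋ ∧ t) (bitVecs m) ≡ indicator t
count-≟ᵇ-∧ {m} X true  =
  trans (count-cong (λ Y → ∧-identityʳ ⌊ X ≟ᵇ Y ⌋) (bitVecs m)) (count-≟ᵇ X)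
count-≟ᵇ-∧ {m} X false =
  trans (count-cong (λ Y → ∧-zeroʳ ⌊ X ≟ᵇ Y ⌋) (bitVecs m)) (count-false (bitVecs m))

DifferAt : ∀ {m} → Fin m → Vec Bool m → Vec Bool m → Set
DifferAt k X Y =
  Vec.lookup X k ≢ Vec.lookup Y k × (∀ {l} → l ≢ k → Vec.lookup X l ≡ Vec.lookup Y l)

differInOne : ∀ {m} → Vec Bool m → Vec Bool m → Bool
differInOne []ᵛ       []ᵛ       = false
differInOne (x ∷ᵛ X) (y ∷ᵛ Y) = if ⌊ x Bool.≟ y ⌋ then differInOne X Y else ⌊ X ≟ᵇ Y ⌋

differInOne⁺ : ∀ {m} {k : Fin m} (X Y : Vec Bool m) → DifferAt k X Y → T (differInOne X Y)
differInOne⁺ {k = zero} (x ∷ᵛ X) (y ∷ᵛ Y) (x≢y , rest) with x Bool.≟ y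
... | yes x≡y = ⊥-elim (x≢y x≡y)
... | no _    = fromWitness (lookup-ext (λ l → rest {suc l} (λ ())))
differInOne⁺ {k = suc k} (x ∷ᵛ X) (y ∷ᵛ Y) (X≢Y , rest) with x Bool.≟ y
... | yes _   = differInOne⁺ X Y (X≢Y , λ l≢k → rest (l≢k ∘ suc-injective))
... | no x≢y  = ⊥-elim (x≢y (rest {zero} (λ ())))

differInOne⁻ : ∀ {m} (X Y : Vec Bool m) → T (differInOne X Y) → ∃ λ k → DifferAt k X Y
differInOne⁻ []ᵛ       []ᵛ       ()
differInOne⁻ (x ∷ᵛ X) (y ∷ᵛ Y) h with x Bool.≟ y
... | yes x≡y = let k , X≢Y , rest = differInOne⁻ X Y h in
  suc k , X≢Y , λ { {zero} _ → x≡y ; {suc l} l≢k → rest (l≢k ∘ cong suc) }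
... | no x≢y  = zero , x≢y , λ
  { {zero}  0≢0 → ⊥-elim (0≢0 refl)
  ; {suc l} _   → cong (λ Z → Vec.lookup Z l) (toWitness h)
  }

DifferAt-only : ∀ {m} {X Y : Vec Bool m} k → X ≢ Y →
  (∀ {l} → l ≢ k → Vec.lookup X l ≡ Vec.lookup Y l) → DifferAt k X Y
DifferAt-only {X = X} {Y} k X≢Y rest = (λ Xk≡Yk → X≢Y (lookup-ext (pointwise Xk≡Yk))) , rest
  where
  pointwise : Vec.lookup X k ≡ Vec.lookup Y k → ∀ l → Vec.lookup X l ≡ Vec.lookup Y l
  pointwise Xk≡Yk l with l ≟ k
  ... | yes refl = Xk≡Yk
  ... | no l≢k   = rest l≢k

DifferAt-sym : ∀ {m} {k : Fin m} {X Y} → DifferAt k X Y → DifferAt k Y X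
DifferAt-sym (X≢Y , rest) = X≢Y ∘ sym , sym ∘ rest

differInOne-sym : ∀ {m} (X Y : Vec Bool m) → differInOne X Y ≡ differInOne Y X
differInOne-sym X Y = T-ext (flipped X Y) (flipped Y X)
  where
  flipped : ∀ X Y → T (differInOne X Y) → T (differInOne Y X)
  flipped X Y h = differInOne⁺ Y X (DifferAt-sym {X = X} {Y} (proj₂ (differInOne⁻ X Y h)))

differInOne-irrefl : ∀ {m} (X : Vec Bool m) → differInOne X X ≡ false
differInOne-irrefl X = ¬T⇒false (λ h → proj₁ (proj₂ (differInOne⁻ X X h)) refl)

count-differInOne : ∀ {m} (X : Vec Bool m) → count (differInOne X) (bitVecs m) ≡ m
count-differInOne {zero}  []ᵛ           = refl
count-differInOne {suc m} (true ∷ᵛ X)  = trans (count-bitVecs-suc (differInOne (true ∷ᵛ X)))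
  (trans (cong₂ _+_ (count-differInOne X) (count-≟ᵇ X)) (+-comm m 1))
count-differInOne {suc m} (false ∷ᵛ X) = trans (count-bitVecs-suc (differInOne (false ∷ᵛ X)))
  (cong₂ _+_ (count-≟ᵇ X) (count-differInOne X))

complement : ∀ {m} → Vec Bool m → Vec Bool m
complement = Vec.map not

lookup-complement : ∀ {m} (X : Vec Bool m) k → Vec.lookup (complement X) k ≡ not (Vec.lookup X k)
lookup-complement X k = lookup-map k not X

complement-involutive : ∀ {m} (X : Vec Bool m) → complement (complement X) ≡ X
complement-involutive X = lookup-ext (λ k → trans (lookup-complement (complement X) k)
  (trans (cong not (lookup-complement X k)) (not-involutive _)))

complement-≢ : ∀ {m} → Fin m → (X : Vec Bool m) → complement X ≢ X
complement-≢ k X e =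
  not-¬ refl (trans (sym (cong (λ Z → Vec.lookup Z k) e)) (lookup-complement X k))

complement-≟-sym : ∀ {m} (X Y : Vec Bool m) →
  ⌊ complement X ≟ᵇ Y ⌋ ≡ ⌊ complement Y ≟ᵇ X ⌋
complement-≟-sym X Y = T-ext (fromWitness ∘ flip ∘ toWitness) (fromWitness ∘ flip ∘ toWitness)
  where
  flip : ∀ {X Y} → complement X ≡ Y → complement Y ≡ X
  flip {X} refl = complement-involutive X

¬differInOne-complement : ∀ {m} → 2 ≤ m → (X : Vec Bool m) → ¬ T (differInOne X (complement X))
¬differInOne-complement (s≤s (s≤s _)) X h with differInOne⁻ X (complement X) h
... | k , _ , rest = not-¬ refl (trans (rest (other≢ k)) (lookup-complement X (other k)))
  where
  other : Fin (2 + _) → Fin (2 + _)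
  other zero    = suc zero
  other (suc _) = zero
  other≢ : ∀ k → other k ≢ k
  other≢ zero    ()
  other≢ (suc _) ()

vanishesOnFirst : ∀ a {b} → Vec Bool (a + b) → Bool
vanishesOnFirst zero    X         = true
vanishesOnFirst (suc a) (x ∷ᵛ X) = not x ∧ vanishesOnFirst a X

vanishesAfter : ∀ a {b} → Vec Bool (a + b) → Bool
vanishesAfter zero    X         = ⌊ Vec.replicate _ false ≟ᵇ X ⌋
vanishesAfter (suc a) (x ∷ᵛ X) = vanishesAfter a X

module _ {b : ℕ} where

  vanishesOnFirst⁺ : ∀ a (X : Vec Bool (a + b)) →
    (∀ k → T (toℕ k <ᵇ a) → Vec.lookup X k ≡ false) → T (vanishesOnFirst a X)
  vanishesOnFirst⁺ zero    X         h = tt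
  vanishesOnFirst⁺ (suc a) (x ∷ᵛ X) h rewrite h zero tt = vanishesOnFirst⁺ a X (h ∘ suc)

  vanishesOnFirst⁻ : ∀ a (X : Vec Bool (a + b)) →
    T (vanishesOnFirst a X) → ∀ k → T (toℕ k <ᵇ a) → Vec.lookup X k ≡ false
  vanishesOnFirst⁻ (suc a) (x ∷ᵛ X) h zero    _   = ¬T⇒false (T-not⁻ (proj₁ (T-∧⁻ {not x} h)))
  vanishesOnFirst⁻ (suc a) (x ∷ᵛ X) h (suc k) k<a =
    vanishesOnFirst⁻ a X (proj₂ (T-∧⁻ {not x} h)) k k<a

  vanishesAfter⁺ : ∀ a (X : Vec Bool (a + b)) →
    (∀ k → ¬ T (toℕ k <ᵇ a) → Vec.lookup X k ≡ false) → T (vanishesAfter a X)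
  vanishesAfter⁺ zero    X         h =
    fromWitness (lookup-ext (λ k → trans (lookup-replicate k false) (sym (h k λ ()))))
  vanishesAfter⁺ (suc a) (x ∷ᵛ X) h = vanishesAfter⁺ a X (h ∘ suc)

  vanishesAfter⁻ : ∀ a (X : Vec Bool (a + b)) →
    T (vanishesAfter a X) → ∀ k → ¬ T (toℕ k <ᵇ a) → Vec.lookup X k ≡ false
  vanishesAfter⁻ zero    X         h k       _    =
    trans (cong (λ Z → Vec.lookup Z k) (sym (toWitness h))) (lookup-replicate k false)
  vanishesAfter⁻ (suc a) (x ∷ᵛ X) h zero    ¬0<a = ⊥-elim (¬0<a tt)
  vanishesAfter⁻ (suc a) (x ∷ᵛ X) h (suc k) k≮a  = vanishesAfter⁻ a X h k k≮a

  count-vanishesAfter : ∀ a → count (vanishesAfter a) (bitVecs (a + b)) ≡ 2 ^ a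
  count-vanishesAfter zero    = count-≟ᵇ (Vec.replicate b false)
  count-vanishesAfter (suc a) = trans (count-bitVecs-suc (vanishesAfter (suc a)))
    (trans (cong₂ _+_ (count-vanishesAfter a) (count-vanishesAfter a))
           (cong (2 ^ a +_) (sym (+-identityʳ (2 ^ a)))))

  count-vanishesOnFirst∨After : ∀ a →
    count (λ X → vanishesOnFirst a X ∨ vanishesAfter a X) (bitVecs (a + b)) + 1 ≡ 2 ^ a + 2 ^ b
  count-vanishesOnFirst∨After zero = begin
    count (λ _ → true) (bitVecs b) + 1
      ≡⟨ cong (_+ 1) (trans (count-true (bitVecs b)) (length-bitVecs b)) ⟩
    2 ^ b + 1
      ≡⟨ +-comm (2 ^ b) 1 ⟩
    1 + 2 ^ b
      ∎
    where open ≡-Reasoning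
  count-vanishesOnFirst∨After (suc a) = begin
    count V (bitVecs (suc a + b)) + 1                ≡⟨ cong (_+ 1) (count-bitVecs-suc V) ⟩
    (count (vanishesAfter a) B + count V' B) + 1     ≡⟨ +-assoc (count (vanishesAfter a) B) _ 1 ⟩
    count (vanishesAfter a) B + (count V' B + 1)     ≡⟨ cong₂ _+_ (count-vanishesAfter a)
                                                                  (count-vanishesOnFirst∨After a) ⟩
    2 ^ a + (2 ^ a + 2 ^ b)                          ≡⟨ +-assoc (2 ^ a) (2 ^ a) (2 ^ b) ⟨
    (2 ^ a + 2 ^ a) + 2 ^ b                          ≡⟨ cong (λ c → 2 ^ a + c + 2 ^ b) (+-identityʳ (2 ^ a)) ⟨
    2 ^ suc a + 2 ^ b                                ∎
    where
    open ≡-Reasoning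
    B : List (Vec Bool (a + b))
    B = bitVecs (a + b)
    V : Vec Bool (suc a + b) → Bool
    V X = vanishesOnFirst (suc a) X ∨ vanishesAfter (suc a) X
    V' : Vec Bool (a + b) → Bool
    V' X = vanishesOnFirst a X ∨ vanishesAfter a X

rename : Fin 3 → Fin 3 → Fin 3 → Fin 3
rename p q x = if ⌊ x ≟ p ⌋ then zero else if ⌊ x ≟ q ⌋ then suc zero else suc (suc zero)

rename-injective : ∀ {p q} → p ≢ q → Injective _≡_ _≡_ (rename p q)
rename-injective {p} {q} p≢q = decided p q p≢q _ _
  where
  -- checked by evaluation on all of Fin 3
  decided : ∀ p q → p ≢ q → ∀ x y → rename p q x ≡ rename p q y → x ≡ y
  decided = from-yes (all? λ p → all? λ q → ¬? (p ≟ q) →-dec all? λ x → all? λ y →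
    (rename p q x ≟ rename p q y) →-dec (x ≟ y))

rename-first : ∀ p q → rename p q p ≡ zero
rename-first p q with p ≟ p
... | yes _   = refl
... | no p≢p  = ⊥-elim (p≢p refl)

rename-second : ∀ {p q} → q ≢ p → rename p q q ≡ suc zero
rename-second {p} {q} q≢p with q ≟ p | q ≟ q
... | yes q≡p | _       = ⊥-elim (q≢p q≡p)
... | no _    | yes _   = refl
... | no _    | no q≢q  = ⊥-elim (q≢q refl)

rename-other : ∀ {p q x} → x ≢ p → x ≢ q → rename p q x ≡ suc (suc zero)
rename-other {p} {q} {x} x≢p x≢q with x ≟ p | x ≟ q
... | yes x≡p | _       = ⊥-elim (x≢p x≡p)
... | no _    | yes x≡q = ⊥-elim (x≢q x≡q)
... | no _    | no _    = refl

fin3-middle : ∀ {y : Fin 3} → y ≢ zero → y ≢ suc (suc zero) → y ≡ suc zero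
fin3-middle {zero}           y≢0 _   = ⊥-elim (y≢0 refl)
fin3-middle {suc zero}       _   _   = refl
fin3-middle {suc (suc zero)} _   y≢2 = ⊥-elim (y≢2 refl)

transpose-injective : ∀ {n} (i j : Fin n) → Injective _≡_ _≡_ (transpose i j)
transpose-injective i j e =
  trans (sym (transpose-inverse j i)) (trans (cong (transpose j i) e) (transpose-inverse j i))

-- The double broom B(3,a,b)

module DoubleBroom (a b : ℕ) where

  N : ℕ
  N = 3 + a + b

  G : Graph N
  G = doubleBroom a b

  u v w : Fin N
  u = zero
  v = suc zero
  w = suc (suc zero)

  leaf : Fin (a + b) → Fin N
  leaf k = suc (suc (suc k))

  leaf-injective : ∀ {k l} → leaf k ≡ leaf l → k ≡ l
  leaf-injective = suc-injective ∘ suc-injective ∘ suc-injective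

  atU : Fin (a + b) → Bool
  atU k = toℕ k <ᵇ a

  data Edge : Fin N → Fin N → Set where
    u–v    : Edge u v
    v–w    : Edge v w
    u–leaf : ∀ {k} → T (atU k) → Edge u (leaf k)
    w–leaf : ∀ {k} → T (not (atU k)) → Edge w (leaf k)

  edge-adjacent : ∀ {i j} → Edge i j → T (G i j)
  edge-adjacent u–v            = tt
  edge-adjacent v–w            = tt
  edge-adjacent (u–leaf t)     = T-∨⁺ˡ (T-∨⁺ˡ t)
  edge-adjacent (w–leaf {k} t) = T-∨⁺ˡ (subst T (sym (<ᵇ-suc a (toℕ k))) t)

  adjacent-edge : ∀ {i j} → T (G i j) → Edge i j ⊎ Edge j i
  adjacent-edge {zero}              {suc zero}          _ = inj₁ u–v
  adjacent-edge {suc zero}          {zero}              _ = inj₂ u–v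
  adjacent-edge {suc zero}          {suc (suc zero)}    _ = inj₁ v–w
  adjacent-edge {suc (suc zero)}    {suc zero}          _ = inj₂ v–w
  adjacent-edge {zero}              {suc (suc (suc k))} g = inj₁ (u–leaf (T-∨false⁻ (T-∨false⁻ g)))
  adjacent-edge {suc (suc (suc k))} {zero}              g = inj₂ (u–leaf (T-∨false⁻ g))
  adjacent-edge {suc (suc zero)}    {suc (suc (suc k))} g =
    inj₁ (w–leaf (subst T (<ᵇ-suc a (toℕ k)) (T-∨false⁻ g)))
  adjacent-edge {suc (suc (suc k))} {suc (suc zero)}    g = inj₂ (w–leaf (subst T (<ᵇ-suc a (toℕ k)) g))
  adjacent-edge {zero}              {zero}              ()
  adjacent-edge {zero}              {suc (suc zero)}    ()
  adjacent-edge {suc zero}          {suc zero}          ()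
  adjacent-edge {suc zero}          {suc (suc (suc _))} ()
  adjacent-edge {suc (suc zero)}    {zero}              ()
  adjacent-edge {suc (suc zero)}    {suc (suc zero)}    ()
  adjacent-edge {suc (suc (suc _))} {suc zero}          ()
  adjacent-edge {suc (suc (suc _))} {suc (suc (suc _))} ()

  -- In the colouring of (s , X), v has colour 0 and u colour 1; s says whether w shares the
  -- colour of u, and X k whether leaf k avoids colour 0, in which case it takes the colour
  -- in {1, 2} that its neighbour does not have.
  Code : Set
  Code = Bool × Vec Bool (a + b)

  wColour : Bool → Fin 3
  wColour s = if s then suc zero else suc (suc zero)

  leafColour : Bool → Bool → Bool → Fin 3
  leafColour _     _     false = zero
  leafColour true  _     true  = suc (suc zero)
  leafColour false true  true  = suc (suc zero)
  leafColour false false true  = suc zero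

  colouring : Code → Fin N → Fin 3
  colouring (s , X) zero                = suc zero
  colouring (s , X) (suc zero)          = zero
  colouring (s , X) (suc (suc zero))    = wColour s
  colouring (s , X) (suc (suc (suc k))) = leafColour s (atU k) (Vec.lookup X k)

  partition : Code → Rel N
  partition c = kernel (colouring c)

  u≢leafColour : ∀ s {t} → T t → ∀ x → suc zero ≢ leafColour s t x
  u≢leafColour s     {true} _ false ()
  u≢leafColour true  {true} _ true  ()
  u≢leafColour false {true} _ true  ()

  w≢leafColour : ∀ s {t} → T (not t) → ∀ x → wColour s ≢ leafColour s t x
  w≢leafColour true  {false} _ false ()
  w≢leafColour true  {false} _ true  ()
  w≢leafColour false {false} _ false ()
  w≢leafColour false {false} _ true  ()

  colouring-proper-on-edges : ∀ c {i j} → Edge i j → colouring c i ≢ colouring c j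
  colouring-proper-on-edges (s     , X) u–v ()
  colouring-proper-on-edges (true  , X) v–w ()
  colouring-proper-on-edges (false , X) v–w ()
  colouring-proper-on-edges (s , X) (u–leaf {k} t) = u≢leafColour s t (Vec.lookup X k)
  colouring-proper-on-edges (s , X) (w–leaf {k} t) = w≢leafColour s t (Vec.lookup X k)

  colouring-proper : ∀ c → Proper G (colouring c)
  colouring-proper c i j g =
    [ colouring-proper-on-edges c , (λ e → colouring-proper-on-edges c e ∘ sym) ] (adjacent-edge {i} {j} g)

  partition-stable : ∀ c → T (isStablePartition N 3 G (partition c))
  partition-stable c = kernel-stable G (colouring c) (colouring-proper c)

  codeOf : (Fin N → Fin 3) → Code
  codeOf col = ⌊ col u ≟ col w ⌋ , tabulate (λ k → not ⌊ col (leaf k) ≟ col v ⌋)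

  kernel-canonical : ∀ col → Proper G col → kernel col ≡ partition (codeOf col)
  kernel-canonical col proper = kernel-rename {c = col} (rename p q) rename-inj renamed
    where
    p q : Fin 3
    p = col v
    q = col u

    separated : ∀ {i j} → Edge i j → col i ≢ col j
    separated {i} {j} e = proper i j (edge-adjacent e)

    q≢p : q ≢ p
    q≢p = separated u–v

    w≢p : col w ≢ p
    w≢p = separated v–w ∘ sym

    rename-inj : Injective _≡_ _≡_ (rename p q)
    rename-inj = rename-injective (q≢p ∘ sym)

    w-renamed : (d : Dec (q ≡ col w)) → rename p q (col w) ≡ wColour ⌊ d ⌋
    w-renamed (yes q≡w) = trans (cong (rename p q) (sym q≡w)) (rename-second q≢p)
    w-renamed (no q≢w)  = rename-other w≢p (q≢w ∘ sym)

    leaf-renamed : ∀ k (d : Dec (col (leaf k) ≡ p)) (e : Dec (q ≡ col w)) t →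
      (T t → Edge u (leaf k)) → (T (not t) → Edge w (leaf k)) →
      rename p q (col (leaf k)) ≡ leafColour ⌊ e ⌋ t (not ⌊ d ⌋)
    leaf-renamed k (yes ℓ≡p) _         _     _   _   = trans (cong (rename p q) ℓ≡p) (rename-first p q)
    leaf-renamed k (no ℓ≢p)  (yes _)   true  toU _   = rename-other ℓ≢p (separated (toU tt) ∘ sym)
    leaf-renamed k (no ℓ≢p)  (no _)    true  toU _   = rename-other ℓ≢p (separated (toU tt) ∘ sym)
    leaf-renamed k (no ℓ≢p)  (yes q≡w) false _   toW =
      rename-other ℓ≢p (λ ℓ≡q → separated (toW tt) (sym (trans ℓ≡q q≡w)))
    leaf-renamed k (no ℓ≢p)  (no q≢w)  false _   toW = fin3-middle
      (ℓ≢p ∘ rename-inj ∘ (λ e → trans e (sym (rename-first p q))))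
      (separated (toW tt) ∘ sym ∘ rename-inj
        ∘ (λ e → trans e (sym (rename-other w≢p (q≢w ∘ sym)))))

    renamed : ∀ i → rename p q (col i) ≡ colouring (codeOf col) i
    renamed zero                = rename-second q≢p
    renamed (suc zero)          = rename-first p q
    renamed (suc (suc zero))    = w-renamed (q ≟ col w)
    renamed (suc (suc (suc k))) =
      trans (leaf-renamed k (col (leaf k) ≟ p) (q ≟ col w) (atU k) u–leaf w–leaf)
            (cong (leafColour ⌊ q ≟ col w ⌋ (atU k))
                  (sym (lookup∘tabulate (λ k → not ⌊ col (leaf k) ≟ p ⌋) k)))

  stable⇒partition : ∀ {R} → T (isStablePartition N 3 G R) → ∃ λ c → R ≡ partition c
  stable⇒partition {R} stable =
    let col , proper , R≡kernel = stable⇒kernel {N} {3} G R stable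
    in codeOf col , trans R≡kernel (kernel-canonical col proper)

  u~w : ∀ s X → rel (partition (s , X)) u w ≡ s
  u~w true  X = rel-kernel (colouring (true , X)) u w
  u~w false X = rel-kernel (colouring (false , X)) u w

  leaf~v : ∀ s X k → rel (partition (s , X)) (leaf k) v ≡ not (Vec.lookup X k)
  leaf~v s X k = trans (rel-kernel (colouring (s , X)) (leaf k) v) (reading s (atU k) (Vec.lookup X k))
    where
    reading : ∀ s t x → ⌊ leafColour s t x ≟ zero ⌋ ≡ not x
    reading _     _     false = refl
    reading true  _     true  = refl
    reading false true  true  = refl
    reading false false true  = refl

  leaf~w-apart : ∀ X k → T (atU k) → rel (partition (false , X)) (leaf k) w ≡ Vec.lookup X k
  leaf~w-apart X k t =
    trans (rel-kernel (colouring (false , X)) (leaf k) w) (reading t (Vec.lookup X k))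
    where
    reading : ∀ {t} → T t → ∀ x → ⌊ leafColour false t x ≟ wColour false ⌋ ≡ x
    reading {true} _ false = refl
    reading {true} _ true  = refl

  leaf~u-apart : ∀ X k → T (not (atU k)) → rel (partition (false , X)) (leaf k) u ≡ Vec.lookup X k
  leaf~u-apart X k t =
    trans (rel-kernel (colouring (false , X)) (leaf k) u) (reading t (Vec.lookup X k))
    where
    reading : ∀ {t} → T (not t) → ∀ x → ⌊ leafColour false t x ≟ suc zero ⌋ ≡ x
    reading {false} _ false = refl
    reading {false} _ true  = refl

  leafColour-together≢1 : ∀ t x → ⌊ leafColour true t x ≟ suc zero ⌋ ≡ false
  leafColour-together≢1 _ false = refl
  leafColour-together≢1 _ true  = refl

  leaf≁u-together : ∀ X k → rel (partition (true , X)) (leaf k) u ≡ false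
  leaf≁u-together X k = trans (rel-kernel (colouring (true , X)) (leaf k) u)
                              (leafColour-together≢1 (atU k) (Vec.lookup X k))

  leaf≁w-together : ∀ X k → rel (partition (true , X)) (leaf k) w ≡ false
  leaf≁w-together X k = trans (rel-kernel (colouring (true , X)) (leaf k) w)
                              (leafColour-together≢1 (atU k) (Vec.lookup X k))

  leaf~leaf-together : ∀ X k l →
    rel (partition (true , X)) (leaf k) (leaf l) ≡ ⌊ Vec.lookup X k Bool.≟ Vec.lookup X l ⌋
  leaf~leaf-together X k l = trans (rel-kernel (colouring (true , X)) (leaf k) (leaf l))
                                   (reading (atU k) (atU l) (Vec.lookup X k) (Vec.lookup X l))
    where
    reading : ∀ t t' x y → ⌊ leafColour true t x ≟ leafColour true t' y ⌋ ≡ ⌊ x Bool.≟ y ⌋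
    reading _ _ false false = refl
    reading _ _ false true  = refl
    reading _ _ true  false = refl
    reading _ _ true  true  = refl

  partition-injective : ∀ {c c'} → partition c ≡ partition c' → c ≡ c'
  partition-injective {s , X} {s' , Y} P≡P' = cong₂ _,_
    (trans (sym (u~w s X)) (trans (cong (λ P → rel P u w) P≡P') (u~w s' Y)))
    (lookup-ext (λ k → not-injective
      (trans (sym (leaf~v s X k)) (trans (cong (λ P → rel P (leaf k) v) P≡P') (leaf~v s' Y k)))))

  codes : List Code
  codes = map (true ,_) (bitVecs (a + b)) ++ map (false ,_) (bitVecs (a + b))

  codes-unique : Unique codes
  codes-unique = Unique.++⁺ (Unique.map⁺ (cong proj₂) (bitVecs-unique _))
                            (Unique.map⁺ (cong proj₂) (bitVecs-unique _))
    λ (∈true , ∈false) → let _ , _ , e  = ∈-map⁻ (true ,_) ∈true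
                             _ , _ , e' = ∈-map⁻ (false ,_) ∈false
                         in true≢false (cong proj₁ (trans (sym e) e'))

  ∈-codes : ∀ c → c ∈ codes
  ∈-codes (true  , X) = ∈-++⁺ˡ (∈-map⁺ (true ,_) (∈-bitVecs X))
  ∈-codes (false , X) = ∈-++⁺ʳ (map (true ,_) (bitVecs (a + b))) (∈-map⁺ (false ,_) (∈-bitVecs X))

  stablePartitions-↭ : stablePartitions N 3 G ↭ map partition codes
  stablePartitions-↭ = ↭-from-∈
    (Unique.filter⁺ (T? ∘ isStablePartition N 3 G) (allRels-unique N))
    (Unique.map⁺ partition-injective codes-unique)
    (λ {R} R∈ → let _ , stable = ∈-filter⁻ (T? ∘ isStablePartition N 3 G) {xs = allRels N} R∈
                    c , R≡ = stable⇒partition stable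
                in subst (_∈ map partition codes) (sym R≡) (∈-map⁺ partition (∈-codes c)))
    (λ {R} R∈ → let c , _ , R≡ = ∈-map⁻ partition R∈
                in subst (_∈ stablePartitions N 3 G) (sym R≡)
                     (∈-filter⁺ (T? ∘ isStablePartition N 3 G) (∈-allRels (partition c))
                                (partition-stable c)))

  splittable : Vec Bool (a + b) → Bool
  splittable X = vanishesOnFirst a X ∨ vanishesAfter a X

  codeAdj : Code → Code → Bool
  codeAdj (true  , X) (true  , Y) = differInOne X Y ∨ ⌊ complement X ≟ᵇ Y ⌋
  codeAdj (false , X) (false , Y) = differInOne X Y
  codeAdj (true  , X) (false , Y) = ⌊ X ≟ᵇ Y ⌋ ∧ splittable X
  codeAdj (false , X) (true  , Y) = codeAdj (true , Y) (false , X)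

  adjacent-codes : ∀ c c' {x} → c ≢ c' → AgreeOff (partition c) (partition c') x →
    Adjacent (partition c) (partition c')
  adjacent-codes c c' {x} c≢c' agree = c≢c' ∘ partition-injective , x , agree

  leaf-move : ∀ s {X Y} k → DifferAt k X Y → Adjacent (partition (s , X)) (partition (s , Y))
  leaf-move s {X} {Y} k (Xk≢Yk , rest) =
    adjacent-codes (s , X) (s , Y) (Xk≢Yk ∘ cong (λ c → Vec.lookup (proj₂ c) k))
      (kernel-agreeOff {c = colouring (s , X)} {colouring (s , Y)} id id unchanged)
    where
    unchanged : ∀ i → i ≢ leaf k → colouring (s , X) i ≡ colouring (s , Y) i
    unchanged zero                _   = refl
    unchanged (suc zero)          _   = refl
    unchanged (suc (suc zero))    _   = refl
    unchanged (suc (suc (suc l))) ℓ≢k = cong (leafColour s (atU l)) (rest (ℓ≢k ∘ cong leaf))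

  v-move : Fin (a + b) → ∀ X → Adjacent (partition (true , X)) (partition (true , complement X))
  v-move k X = adjacent-codes (true , X) (true , complement X) (complement-≢ k X ∘ sym ∘ cong proj₂)
    (kernel-agreeOff {c = colouring (true , X)} {colouring (true , complement X)}
                     swap₀₂ (transpose-injective _ _) moved)
    where
    swap₀₂ : Fin 3 → Fin 3
    swap₀₂ = transpose zero (suc (suc zero))
    flipped : ∀ t x → swap₀₂ (leafColour true t x) ≡ leafColour true t (not x)
    flipped _ false = refl
    flipped _ true  = refl
    moved : ∀ i → i ≢ v → swap₀₂ (colouring (true , X) i) ≡ colouring (true , complement X) i
    moved zero                _   = refl
    moved (suc zero)          v≢v = ⊥-elim (v≢v refl)
    moved (suc (suc zero))    _   = refl
    moved (suc (suc (suc l))) _   = trans (flipped (atU l) (Vec.lookup X l))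
      (cong (leafColour true (atU l)) (sym (lookup-complement X l)))

  u-move : ∀ X → T (vanishesOnFirst a X) → Adjacent (partition (true , X)) (partition (false , X))
  u-move X vanish = adjacent-codes (true , X) (false , X) (λ ())
    (kernel-agreeOff {c = colouring (true , X)} {colouring (false , X)}
                     swap₁₂ (transpose-injective _ _) moved)
    where
    swap₁₂ : Fin 3 → Fin 3
    swap₁₂ = transpose (suc zero) (suc (suc zero))
    leaf-moved : ∀ t x → (T t → x ≡ false) → swap₁₂ (leafColour true t x) ≡ leafColour false t x
    leaf-moved _     false _        = refl
    leaf-moved true  true  vanishes = ⊥-elim (true≢false (vanishes tt))
    leaf-moved false true  _        = refl
    moved : ∀ i → i ≢ u → swap₁₂ (colouring (true , X) i) ≡ colouring (false , X) i
    moved zero                u≢u = ⊥-elim (u≢u refl)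
    moved (suc zero)          _   = refl
    moved (suc (suc zero))    _   = refl
    moved (suc (suc (suc l))) _   = leaf-moved (atU l) (Vec.lookup X l) (vanishesOnFirst⁻ a X vanish l)

  w-move : ∀ X → T (vanishesAfter a X) → Adjacent (partition (true , X)) (partition (false , X))
  w-move X vanish = adjacent-codes (true , X) (false , X) (λ ())
    (kernel-agreeOff {c = colouring (true , X)} {colouring (false , X)} id id moved)
    where
    leaf-moved : ∀ t x → (T (not t) → x ≡ false) → leafColour true t x ≡ leafColour false t x
    leaf-moved _     false _        = refl
    leaf-moved true  true  _        = refl
    leaf-moved false true  vanishes = ⊥-elim (true≢false (vanishes tt))
    moved : ∀ i → i ≢ w → colouring (true , X) i ≡ colouring (false , X) i
    moved zero                _   = refl
    moved (suc zero)          _   = refl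
    moved (suc (suc zero))    w≢w = ⊥-elim (w≢w refl)
    moved (suc (suc (suc l))) _   =
      leaf-moved (atU l) (Vec.lookup X l) (vanishesAfter⁻ a X vanish l ∘ T-not⁻)

  codeAdj⇒adjacent : Fin (a + b) → ∀ c c' → T (codeAdj c c') → Adjacent (partition c) (partition c')
  codeAdj⇒adjacent k (true , X) (true , Y) h with T-∨⁻ {differInOne X Y} h
  ... | inj₁ d = let l , diff = differInOne⁻ X Y d in leaf-move true {X} {Y} l diff
  ... | inj₂ e with toWitness e
  ...   | refl = v-move k X
  codeAdj⇒adjacent k (false , X) (false , Y) h =
    let l , diff = differInOne⁻ X Y h in leaf-move false {X} {Y} l diff
  codeAdj⇒adjacent k (true , X) (false , Y) h with T-∧⁻ {⌊ X ≟ᵇ Y ⌋} h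
  ... | X≡Y , split with toWitness X≡Y | T-∨⁻ {vanishesOnFirst a X} split
  ...   | refl | inj₁ vanish = u-move X vanish
  ...   | refl | inj₂ vanish = w-move X vanish
  codeAdj⇒adjacent k (false , X) (true , Y) h =
    Adjacent-sym (codeAdj⇒adjacent k (true , Y) (false , X) h)

  differInOne⇒codeAdj : ∀ s {X Y} → T (differInOne X Y) → T (codeAdj (s , X) (s , Y))
  differInOne⇒codeAdj true  d = T-∨⁺ˡ d
  differInOne⇒codeAdj false d = d

  module _ s X s' Y {x : Fin N} (agree : AgreeOff (partition (s , X)) (partition (s' , Y)) x) where

    sides-agree : u ≢ x → w ≢ x → s ≡ s'
    sides-agree u≢x w≢x = trans (sym (u~w s X)) (trans (agreement agree u w u≢x w≢x) (u~w s' Y))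

    bits-agree : v ≢ x → ∀ k → leaf k ≢ x → Vec.lookup X k ≡ Vec.lookup Y k
    bits-agree v≢x k ℓ≢x = not-injective
      (trans (sym (leaf~v s X k)) (trans (agreement agree (leaf k) v ℓ≢x v≢x) (leaf~v s' Y k)))

    all-bits-agree : v ≢ x → (∀ k → leaf k ≢ x) → X ≡ Y
    all-bits-agree v≢x ℓ≢x = lookup-ext (λ k → bits-agree v≢x k (ℓ≢x k))

  u-removed : ∀ {X Y} → AgreeOff (partition (true , X)) (partition (false , Y)) u →
    T (codeAdj (true , X) (false , Y))
  u-removed {X} {Y} agree = T-∧⁺ (fromWitness X≡Y) (T-∨⁺ˡ (vanishesOnFirst⁺ a X vanish))
    where
    X≡Y : X ≡ Y
    X≡Y = all-bits-agree true X false Y agree (λ ()) (λ _ ())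
    vanish : ∀ k → T (atU k) → Vec.lookup X k ≡ false
    vanish k t = begin
      Vec.lookup X k                         ≡⟨ cong (λ Z → Vec.lookup Z k) X≡Y ⟩
      Vec.lookup Y k                         ≡⟨ leaf~w-apart Y k t ⟨
      rel (partition (false , Y)) (leaf k) w ≡⟨ agreement agree (leaf k) w (λ ()) (λ ()) ⟨
      rel (partition (true , X)) (leaf k) w  ≡⟨ leaf≁w-together X k ⟩
      false                                  ∎
      where open ≡-Reasoning

  w-removed : ∀ {X Y} → AgreeOff (partition (true , X)) (partition (false , Y)) w →
    T (codeAdj (true , X) (false , Y))
  w-removed {X} {Y} agree = T-∧⁺ {⌊ X ≟ᵇ Y ⌋} (fromWitness X≡Y)
    (T-∨⁺ʳ {vanishesOnFirst a X} (vanishesAfter⁺ a X (λ k → vanish k ∘ T-not⁺)))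
    where
    X≡Y : X ≡ Y
    X≡Y = all-bits-agree true X false Y agree (λ ()) (λ _ ())
    vanish : ∀ k → T (not (atU k)) → Vec.lookup X k ≡ false
    vanish k t = begin
      Vec.lookup X k                         ≡⟨ cong (λ Z → Vec.lookup Z k) X≡Y ⟩
      Vec.lookup Y k                         ≡⟨ leaf~u-apart Y k t ⟨
      rel (partition (false , Y)) (leaf k) u ≡⟨ agreement agree (leaf k) u (λ ()) (λ ()) ⟨
      rel (partition (true , X)) (leaf k) u  ≡⟨ leaf≁u-together X k ⟩
      false                                  ∎
      where open ≡-Reasoning

  v-removed-apart : ∀ {X Y} → AgreeOff (partition (false , X)) (partition (false , Y)) v → X ≡ Y
  v-removed-apart {X} {Y} agree = lookup-ext bit
    where
    bit : ∀ k → Vec.lookup X k ≡ Vec.lookup Y k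
    bit k with T? (atU k)
    ... | yes t = trans (sym (leaf~w-apart X k t))
                        (trans (agreement agree (leaf k) w (λ ()) (λ ())) (leaf~w-apart Y k t))
    ... | no ¬t = trans (sym (leaf~u-apart X k (T-not⁺ ¬t)))
                        (trans (agreement agree (leaf k) u (λ ()) (λ ())) (leaf~u-apart Y k (T-not⁺ ¬t)))

  leaf-shape-agrees : ∀ X Y → AgreeOff (partition (true , X)) (partition (true , Y)) v → ∀ k l →
    ⌊ Vec.lookup X k Bool.≟ Vec.lookup X l ⌋ ≡ ⌊ Vec.lookup Y k Bool.≟ Vec.lookup Y l ⌋
  leaf-shape-agrees X Y agree k l = trans (sym (leaf~leaf-together X k l))
    (trans (agreement agree (leaf k) (leaf l) (λ ()) (λ ())) (leaf~leaf-together Y k l))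

  -- Which leaves share a part with a fixed leaf k* determines X up to complement.
  v-removed-together : Fin (a + b) → ∀ {X Y} →
    AgreeOff (partition (true , X)) (partition (true , Y)) v → X ≢ Y → complement X ≡ Y
  v-removed-together k* {X} {Y} agree X≢Y with Vec.lookup X k* Bool.≟ Vec.lookup Y k*
  ... | yes same = ⊥-elim (X≢Y (lookup-ext (λ k → ≟-cancelʳ _ _ _ (trans (leaf-shape-agrees X Y agree k k*)
                     (cong (λ y → ⌊ Vec.lookup Y k Bool.≟ y ⌋) (sym same))))))
  ... | no differ = lookup-ext (λ k → trans (lookup-complement X k) (≟-cancelʳ-not _ _ _
                      (trans (leaf-shape-agrees X Y agree k k*)
                             (cong (λ y → ⌊ Vec.lookup Y k Bool.≟ y ⌋) (¬-not (differ ∘ sym))))))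

  agreeOff⇒codeAdj : Fin (a + b) → ∀ c c' → c ≢ c' → ∀ x →
    AgreeOff (partition c) (partition c') x → T (codeAdj c c')
  agreeOff⇒codeAdj _  (s , X) (s' , Y) c≢c' (suc (suc (suc k))) agree
    with sides-agree s X s' Y agree (λ ()) (λ ())
  ... | refl = differInOne⇒codeAdj s (differInOne⁺ X Y (DifferAt-only k (c≢c' ∘ cong (s ,_))
                 (λ {l} l≢k → bits-agree s X s Y agree (λ ()) l (l≢k ∘ leaf-injective))))
  agreeOff⇒codeAdj _  (true  , X) (false , Y) _ zero             agree = u-removed agree
  agreeOff⇒codeAdj _  (false , X) (true  , Y) _ zero             agree = u-removed (AgreeOff-sym agree)
  agreeOff⇒codeAdj _  (true  , X) (false , Y) _ (suc (suc zero)) agree = w-removed agree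
  agreeOff⇒codeAdj _  (false , X) (true  , Y) _ (suc (suc zero)) agree = w-removed (AgreeOff-sym agree)
  agreeOff⇒codeAdj _  (s , X) (s' , Y) c≢c' (suc zero) agree with sides-agree s X s' Y agree (λ ()) (λ ())
  agreeOff⇒codeAdj _  (false , X) (false , Y) c≢c' (suc zero) agree | refl =
    ⊥-elim (c≢c' (cong (false ,_) (v-removed-apart agree)))
  agreeOff⇒codeAdj k* (true , X) (true , Y) c≢c' (suc zero) agree | refl =
    T-∨⁺ʳ {differInOne X Y} (fromWitness (v-removed-together k* agree (c≢c' ∘ cong (true ,_))))
  agreeOff⇒codeAdj _  (true  , X) (true  , Y) c≢c' zero agree =
    ⊥-elim (c≢c' (cong (true ,_) (all-bits-agree true X true Y agree (λ ()) (λ _ ()))))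
  agreeOff⇒codeAdj _  (false , X) (false , Y) c≢c' zero agree =
    ⊥-elim (c≢c' (cong (false ,_) (all-bits-agree false X false Y agree (λ ()) (λ _ ()))))
  agreeOff⇒codeAdj _  (true  , X) (true  , Y) c≢c' (suc (suc zero)) agree =
    ⊥-elim (c≢c' (cong (true ,_) (all-bits-agree true X true Y agree (λ ()) (λ _ ()))))
  agreeOff⇒codeAdj _  (false , X) (false , Y) c≢c' (suc (suc zero)) agree =
    ⊥-elim (c≢c' (cong (false ,_) (all-bits-agree false X false Y agree (λ ()) (λ _ ()))))

  reconfAdj-partition : Fin (a + b) → ∀ c c' → reconfAdj N (partition c) (partition c') ≡ codeAdj c c'
  reconfAdj-partition k* c c' = T-ext
    (λ h → let P≢P' , x , agree = reconfAdj⁻ (partition c) (partition c') h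
           in agreeOff⇒codeAdj k* c c' (P≢P' ∘ cong partition) x agree)
    (reconfAdj⁺ (partition c) (partition c') ∘ codeAdj⇒adjacent k* c c')

  togetherAdj : Vec Bool (a + b) → Vec Bool (a + b) → Bool
  togetherAdj X Y = codeAdj (true , X) (true , Y)

  module _ (k* : Fin (a + b)) where

    private
      B : List (Vec Bool (a + b))
      B = bitVecs (a + b)

    reconfEdges-layers : reconfEdges N 3 G ≡
      countEdges togetherAdj B + countEdges differInOne B + count splittable B
    reconfEdges-layers = begin
      countEdges (reconfAdj N) (stablePartitions N 3 G)
        ≡⟨ countEdges-↭ (reconfAdj N) (reconfAdj-sym {N}) stablePartitions-↭ ⟩
      countEdges (reconfAdj N) (map partition codes)
        ≡⟨ countEdges-map (reconfAdj N) partition codes ⟩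
      countEdges (λ c c' → reconfAdj N (partition c) (partition c')) codes
        ≡⟨ countEdges-cong _ (reconfAdj-partition k*) codes ⟩
      countEdges codeAdj (map (true ,_) B ++ map (false ,_) B)
        ≡⟨ countEdges-++ codeAdj (map (true ,_) B) (map (false ,_) B) ⟩
      countEdges codeAdj (map (true ,_) B) + countEdges codeAdj (map (false ,_) B)
        + crossEdges codeAdj (map (true ,_) B) (map (false ,_) B)
        ≡⟨ cong₂ _+_ (cong₂ _+_ (countEdges-map codeAdj (true ,_) B)
                                (countEdges-map codeAdj (false ,_) B))
                     crossEdges-layers ⟩
      countEdges togetherAdj B + countEdges differInOne B + count splittable B
        ∎
      where
      open ≡-Reasoning
      crossEdges-layers : crossEdges codeAdj (map (true ,_) B) (map (false ,_) B) ≡ count splittable B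
      crossEdges-layers = begin
        sum (map (λ c → count (codeAdj c) (map (false ,_) B)) (map (true ,_) B))
          ≡⟨ cong sum (map-∘ B) ⟨
        sum (map (λ X → count (codeAdj (true , X)) (map (false ,_) B)) B)
          ≡⟨ sum-map-cong (λ X → trans (count-map (codeAdj (true , X)) (false ,_) B)
                                       (count-≟ᵇ-∧ X (splittable X))) B ⟩
        sum (map (indicator ∘ splittable) B)
          ≡⟨ sum-map-indicator splittable B ⟩
        count splittable B
          ∎

    countEdges-together : 2 ≤ a + b → 2 * countEdges togetherAdj B ≡ 2 ^ (a + b) * (a + b + 1)
    countEdges-together 2≤m = trans
      (countEdges-regular togetherAdj symmetric irreflexive B degree)
      (cong (_* (a + b + 1)) (length-bitVecs (a + b)))
      where
      symmetric : ∀ X Y → togetherAdj X Y ≡ togetherAdj Y X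
      symmetric X Y = cong₂ _∨_ (differInOne-sym X Y) (complement-≟-sym X Y)
      irreflexive : ∀ X → togetherAdj X X ≡ false
      irreflexive X rewrite differInOne-irrefl X = ¬T⇒false (complement-≢ k* X ∘ toWitness)
      degree : ∀ X → count (togetherAdj X) B ≡ a + b + 1
      degree X = trans
        (count-∨ (differInOne X) (λ Y → ⌊ complement X ≟ᵇ Y ⌋)
          (λ { Y (d , c) →
            ¬differInOne-complement 2≤m X (subst (T ∘ differInOne X) (sym (toWitness c)) d) })
          B)
        (cong₂ _+_ (count-differInOne X) (count-≟ᵇ (complement X)))

  countEdges-apart : 2 * countEdges differInOne (bitVecs (a + b)) ≡ 2 ^ (a + b) * (a + b)
  countEdges-apart = trans
    (countEdges-regular differInOne differInOne-sym differInOne-irrefl (bitVecs (a + b)) count-differInOne)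
    (cong (_* (a + b)) (length-bitVecs (a + b)))

edgeCount-arithmetic : ∀ m P S D C {A B} → 2 ^ m ≡ 2 * P → 2 * S ≡ 2 ^ m * (m + 1) →
  2 * D ≡ 2 ^ m * m → C + 1 ≡ A + B → S + D + C ≡ (2 * m + 1) * P + A + B ∸ 1
edgeCount-arithmetic m P S D C {A} {B} pow twoS twoD C+1 = begin
  S + D + C                        ≡⟨ cong₂ (λ S D → S + D + C) (halve S twoS) (halve D twoD) ⟩
  P * (m + 1) + P * m + C          ≡⟨ collect m P C ⟩
  (2 * m + 1) * P + C              ≡⟨ m+n∸n≡m _ 1 ⟨
  (2 * m + 1) * P + C + 1 ∸ 1      ≡⟨ cong (_∸ 1) (+-assoc ((2 * m + 1) * P) C 1) ⟩
  (2 * m + 1) * P + (C + 1) ∸ 1    ≡⟨ cong (λ x → (2 * m + 1) * P + x ∸ 1) C+1 ⟩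
  (2 * m + 1) * P + (A + B) ∸ 1    ≡⟨ cong (_∸ 1) (+-assoc ((2 * m + 1) * P) A B) ⟨
  (2 * m + 1) * P + A + B ∸ 1      ∎
  where
  open ≡-Reasoning
  halve : ∀ E {d} → 2 * E ≡ 2 ^ m * d → E ≡ P * d
  halve E {d} twoE = *-cancelˡ-≡ E (P * d) 2 (trans twoE (trans (cong (_* d) pow) (*-assoc 2 P d)))
  collect : ∀ m P C → P * (m + 1) + P * m + C ≡ (2 * m + 1) * P + C
  collect = solve 3 (λ m P C → P :* (m :+ con 1) :+ P :* m :+ C := (con 2 :* m :+ con 1) :* P :+ C) refl

lemma5p6 : (a b : ℕ) → 3 ≤ a + b →
    reconfEdges (3 + a + b) 3 (doubleBroom a b)
      ≡ (2 * (a + b) + 1) * 2 ^ (a + b ∸ 1) + 2 ^ a + 2 ^ b ∸ 1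
lemma5p6 a b 3≤m = trans (reconfEdges-layers k*)
  (edgeCount-arithmetic (a + b) (2 ^ (a + b ∸ 1))
    (countEdges togetherAdj B) (countEdges differInOne B) (count splittable B)
    pow (countEdges-together k* 2≤m) countEdges-apart (count-vanishesOnFirst∨After a))
  where
  open DoubleBroom a b
  B : List (Vec Bool (a + b))
  B = bitVecs (a + b)
  1≤m : 1 ≤ a + b
  1≤m = ≤-trans (s≤s z≤n) 3≤m
  k* : Fin (a + b)
  k* = fromℕ< 1≤m
  2≤m : 2 ≤ a + b
  2≤m = ≤-trans (n≤1+n 2) 3≤m
  pow : 2 ^ (a + b) ≡ 2 * 2 ^ (a + b ∸ 1)
  pow = cong (2 ^_) (sym (m+[n∸m]≡n 1≤m))
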